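{- Let $n,B\in\mathbb{N}$ with $B\le n$ and let $f_j=1/j$ for $j\in[n]$. Let $h:[n]\to[B]$ and $s:[n]\to\{ -1,1\}$ be independent, truly (uniformly) random hash functions. For $i\in[n]$ define $\tilde f_i=\sum_{j\in[n]}[h(j)=h(i)]\,s(j)\,f_j$. Then for every $i\in[n]$, $$\mathbb{E}\big[|\tilde f_i-s(i)f_i|\big]=\Theta\!\left(\frac{\log B}{B}\right).$$
   Context: $[E]$ denotes the indicator of the event $E$. This is Count-Sketch with a single hash function on Zipfian frequencies $f_j=1/j$. -}

module Defs where

open import Data.Nat as ℕ using (ℕ; zero; suc)
open import Data.Fin using (Fin; zero; suc; toℕ; _≟_)
open import Data.Integer using (+_; -[1+_])
open import Data.Rational using (ℚ; 0ℚ; _+_; _-_; _*_; _/_; ∣_∣)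
open import Relation.Nullary using (does)
open import Data.Bool using (if_then_else_)
open import Data.Nat.Logarithm using (⌊log₂_⌋)
open import Data.Nat.Properties using (m*n≢0; m^n≢0)

sumFin : (m : ℕ) → (Fin m → ℚ) → ℚ
sumFin zero    g = 0ℚ
sumFin (suc m) g = g zero + sumFin m (λ k → g (suc k))

cons : ∀ {A : Set} {n : ℕ} → A → (Fin n → A) → Fin (suc n) → A
cons a g zero    = a
cons a g (suc k) = g k

sumFuns : (n m : ℕ) → ((Fin n → Fin m) → ℚ) → ℚ
sumFuns zero    m F = F (λ ())
sumFuns (suc n) m F = sumFin m (λ a → sumFuns n m (λ g → F (cons a g)))

-- signs {-1,1} encoded by Fin 2 : zero ↦ 1, suc zero ↦ -1
sgn : Fin 2 → ℚ
sgn zero    = + 1 / 1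
sgn (suc _) = -[1+ 0 ] / 1

-- Zipfian frequency f_j = 1/j for j ∈ [n] = {1,…,n}; element k : Fin n is j = k+1
freq : {n : ℕ} → Fin n → ℚ
freq k = + 1 / suc (toℕ k)

ind : {B : ℕ} → Fin B → Fin B → ℚ
ind x y = if does (x ≟ y) then + 1 / 1 else 0ℚ

estimate : (n B : ℕ) → (Fin n → Fin B) → (Fin n → Fin 2) → Fin n → ℚ
estimate n B h s i = sumFin n (λ j → ind (h j) (h i) * (sgn (s j) * freq j))

-- E[ |f̃_i - s(i) f_i| ] over independent uniform h : [n]→[B], s : [n]→{±1}
expectedError : (n B : ℕ) .{{_ : ℕ.NonZero B}} → Fin n → ℚ
expectedError n B i =
  (sumFuns n B (λ h → sumFuns n 2 (λ s →
      ∣ estimate n B h s i - sgn (s i) * freq i ∣)))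
  * (+ 1 / (B ℕ.^ n ℕ.* 2 ℕ.^ n))
  where instance
    nz : ℕ.NonZero (B ℕ.^ n ℕ.* 2 ℕ.^ n)
    nz = m*n≢0 (B ℕ.^ n) (2 ℕ.^ n) {{m^n≢0 B n}} {{m^n≢0 2 n}}

-- log B / B, with log taken as ⌊log₂ B⌋ (equivalent up to constants for B ≥ 2)
logOver : (B : ℕ) .{{_ : ℕ.NonZero B}} → ℚ
logOver B = + (⌊log₂ B ⌋) / B

module Submission where

-- The error
-- is Σ_{j≠i} [h j = h i] s(j) f_j; split the items j ≠ i into the head (the B
-- heaviest) and the tail.  Upper bound: the head part is at most its colliding
-- mass, of mean H_B/B; the tail part Y satisfies 2|Y| ≤ B Y² + 1/B, and as
-- random signs are orthogonal, E Y² ≤ Σ_{j>B} f_j²/B ≤ 1/B²; so E ≤ (H_B+1)/B.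
-- Lower bound: flipping s(j) moves the error by 2 f_j, so E_s|err| ≥ f_j for
-- every head item j colliding with i, hence ≥ Σ_{j∈D} f_j (1 − #{k∈D : k<j})
-- over the set D of such items; averaging with collision probabilities 1/B and
-- 1/B² gives E ≥ (H_B − 2)/B, and a single heavy item gives E ≥ 1/(2B).
-- Dyadic blocks give 1 + k/2 ≤ H_B ≤ 2 + k.

open import Defs
open import Data.Nat using (ℕ; NonZero) renaming (_≤_ to _≤ₙ_)
open import Data.Fin using (Fin)
open import Data.Product using (Σ; _×_)
open import Data.Rational using (ℚ; 0ℚ; _<_; _≤_; _*_)

import Data.Nat as Nat
open Nat using (zero; suc; s≤s; z≤n; _<ᵇ_)
import Data.Nat.Properties as ℕₚ
import Data.Nat.Tactic.RingSolver as ℕ-Solver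
open import Data.Nat.Logarithm using (⌊log₂_⌋; ⌊log₂⌋-mono-≤; ⌊log₂[2^n]⌋≡n; ⌊log₂⌊n/2⌋⌋≡⌊log₂n⌋∸1)
open import Data.Nat.Induction using (<-rec)
open import Data.Fin using (zero; suc; toℕ; _≟_)
import Data.Integer as ℤ
import Data.Integer.Properties as ℤₚ
open import Data.Rational using (1ℚ; ½; _+_; _-_; -_; _/_; ∣_∣; toℚᵘ; nonNegative)
import Data.Rational.Properties as ℚₚ
import Data.Rational.Unnormalised as ℚᵘ
import Data.Rational.Unnormalised.Properties as ℚᵘₚ
open import Data.Bool using (Bool; true; false; if_then_else_; _∧_; not)
open import Data.Empty using (⊥; ⊥-elim)
open import Data.Sum using (inj₁; inj₂)
open import Data.Product using (_,_; proj₁; proj₂)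
open import Relation.Nullary using (¬_; Dec; does; yes; no)
open import Relation.Nullary.Decidable.Core using (dec⇒maybe)
open import Relation.Binary.PropositionalEquality
open import Tactic.RingSolver using (solve-∀)
open import Level using (0ℓ)
open import Tactic.RingSolver.Core.AlmostCommutativeRing using (AlmostCommutativeRing; fromCommutativeRing)

ℚ-ring : AlmostCommutativeRing 0ℓ 0ℓ
ℚ-ring = fromCommutativeRing ℚₚ.+-*-commutativeRing (λ x → dec⇒maybe (0ℚ ℚₚ.≟ x))

private
  toℚᵘ-/ : ∀ (a : ℤ.ℤ) b → toℚᵘ (a / suc b) ℚᵘ.≃ ℚᵘ.mkℚᵘ a b
  toℚᵘ-/ a b = ℚₚ.toℚᵘ-fromℚᵘ (ℚᵘ.mkℚᵘ a b)

/-≤ : ∀ a b c d → a Nat.* suc d ≤ₙ c Nat.* suc b → ℤ.+ a / suc b ≤ ℤ.+ c / suc d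
/-≤ a b c d le = ℚₚ.toℚᵘ-cancel-≤
  (ℚᵘₚ.≤-respˡ-≃ (ℚᵘₚ.≃-sym (toℚᵘ-/ (ℤ.+ a) b)) (ℚᵘₚ.≤-respʳ-≃ (ℚᵘₚ.≃-sym (toℚᵘ-/ (ℤ.+ c) d))
    (ℚᵘ.*≤* (subst₂ ℤ._≤_ (ℤₚ.pos-* a (suc d)) (ℤₚ.pos-* c (suc b)) (ℤ.+≤+ le)))))

/-≡ : ∀ a b c d → a Nat.* suc d ≡ c Nat.* suc b → ℤ.+ a / suc b ≡ ℤ.+ c / suc d
/-≡ a b c d eq = ℚₚ.toℚᵘ-injective
  (ℚᵘₚ.≃-trans (toℚᵘ-/ (ℤ.+ a) b) (ℚᵘₚ.≃-trans
    (ℚᵘ.*≡* (trans (sym (ℤₚ.pos-* a (suc d))) (trans (cong ℤ.+_ eq) (ℤₚ.pos-* c (suc b)))))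
    (ℚᵘₚ.≃-sym (toℚᵘ-/ (ℤ.+ c) d))))

/-+ : ∀ a b c d → ℤ.+ a / suc b + ℤ.+ c / suc d ≡ ℤ.+ (a Nat.* suc d Nat.+ c Nat.* suc b) / (suc b Nat.* suc d)
/-+ a b c d = ℚₚ.toℚᵘ-injective
  (ℚᵘₚ.≃-trans (ℚₚ.toℚᵘ-homo-+ (ℤ.+ a / suc b) (ℤ.+ c / suc d)) (ℚᵘₚ.≃-trans
    (ℚᵘₚ.+-cong (toℚᵘ-/ (ℤ.+ a) b) (toℚᵘ-/ (ℤ.+ c) d))
    (ℚᵘₚ.≃-trans (ℚᵘₚ.≃-reflexive (cong (λ x → ℚᵘ.mkℚᵘ x _) numerator))
      (ℚᵘₚ.≃-sym (toℚᵘ-/ _ _)))))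
  where
  numerator : ℤ.+ a ℤ.* ℤ.+ suc d ℤ.+ ℤ.+ c ℤ.* ℤ.+ suc b ≡ ℤ.+ (a Nat.* suc d Nat.+ c Nat.* suc b)
  numerator = trans (cong₂ ℤ._+_ (sym (ℤₚ.pos-* a (suc d))) (sym (ℤₚ.pos-* c (suc b))))
                    (sym (ℤₚ.pos-+ (a Nat.* suc d) (c Nat.* suc b)))

/-* : ∀ a b c d → (ℤ.+ a / suc b) * (ℤ.+ c / suc d) ≡ ℤ.+ (a Nat.* c) / (suc b Nat.* suc d)
/-* a b c d = ℚₚ.toℚᵘ-injective
  (ℚᵘₚ.≃-trans (ℚₚ.toℚᵘ-homo-* (ℤ.+ a / suc b) (ℤ.+ c / suc d)) (ℚᵘₚ.≃-trans
    (ℚᵘₚ.*-cong (toℚᵘ-/ (ℤ.+ a) b) (toℚᵘ-/ (ℤ.+ c) d))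
    (ℚᵘₚ.≃-trans (ℚᵘₚ.≃-reflexive (cong (λ x → ℚᵘ.mkℚᵘ x _) (sym (ℤₚ.pos-* a c))))
      (ℚᵘₚ.≃-sym (toℚᵘ-/ _ _)))))

fromℕ : ℕ → ℚ
fromℕ k = ℤ.+ k / 1

fromℕ-+ : ∀ a b → fromℕ (a Nat.+ b) ≡ fromℕ a + fromℕ b
fromℕ-+ a b = sym (trans (/-+ a 0 b 0) (/-≡ (a Nat.* 1 Nat.+ b Nat.* 1) 0 (a Nat.+ b) 0 (eq a b)))
  where
  eq : ∀ a b → (a Nat.* 1 Nat.+ b Nat.* 1) Nat.* 1 ≡ (a Nat.+ b) Nat.* 1
  eq = ℕ-Solver.solve-∀

fromℕ-* : ∀ a b → fromℕ (a Nat.* b) ≡ fromℕ a * fromℕ b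
fromℕ-* a b = sym (/-* a 0 b 0)

fromℕ-mono : ∀ {a b} → a ≤ₙ b → fromℕ a ≤ fromℕ b
fromℕ-mono {a} {b} le = /-≤ a 0 b 0 (ℕₚ.*-monoˡ-≤ 1 le)

fromℕ-nonneg : ∀ a → 0ℚ ≤ fromℕ a
fromℕ-nonneg a = fromℕ-mono {0} {a} z≤n

recip : ℕ → ℚ
recip k = ℤ.+ 1 / suc k

recip-inverse : ∀ k → fromℕ (suc k) * recip k ≡ 1ℚ
recip-inverse k = trans (/-* (suc k) 0 1 k) (/-≡ (suc k Nat.* 1) (k Nat.+ 0) 1 0 (eq k))
  where
  eq : ∀ k → suc k Nat.* 1 Nat.* 1 ≡ 1 Nat.* suc (k Nat.+ 0)
  eq = ℕ-Solver.solve-∀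

-- The same for a positive natural number M that is not syntactically a successor.
fromℕ-inverse : ∀ M .{{_ : NonZero M}} → fromℕ M * (ℤ.+ 1 / M) ≡ 1ℚ
fromℕ-inverse (suc m) = recip-inverse m

recip-nonneg : ∀ k → 0ℚ ≤ recip k
recip-nonneg k = /-≤ 0 0 1 k z≤n

recip-≤1 : ∀ k → recip k ≤ 1ℚ
recip-≤1 k = /-≤ 1 k 1 0 (s≤s z≤n)

recip-antitone : ∀ {a b} → a ≤ₙ b → recip b ≤ recip a
recip-antitone {a} {b} le = /-≤ 1 b 1 a (ℕₚ.*-monoʳ-≤ 1 (s≤s le))

recip-* : ∀ k → recip k * fromℕ k ≤ 1ℚ
recip-* k = ℚₚ.≤-trans (ℚₚ.≤-reflexive (trans (ℚₚ.*-comm (recip k) (fromℕ k)) (/-* k 0 1 k)))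
                       (/-≤ (k Nat.* 1) (k Nat.+ 0) 1 0 (le k))
  where
  le : ∀ k → k Nat.* 1 Nat.* 1 ≤ₙ 1 Nat.* suc (k Nat.+ 0)
  le k = subst (k Nat.* 1 Nat.* 1 ≤ₙ_) (eq k) (ℕₚ.n≤1+n (k Nat.* 1 Nat.* 1))
    where
    eq : ∀ k → suc (k Nat.* 1 Nat.* 1) ≡ 1 Nat.* suc (k Nat.+ 0)
    eq = ℕ-Solver.solve-∀

*-monoˡ-≤ : ∀ {a b c} → 0ℚ ≤ c → a ≤ b → c * a ≤ c * b
*-monoˡ-≤ {c = c} 0≤c = ℚₚ.*-monoˡ-≤-nonNeg c {{nonNegative 0≤c}}

*-monoʳ-≤ : ∀ {a b c} → 0ℚ ≤ c → a ≤ b → a * c ≤ b * c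
*-monoʳ-≤ {c = c} 0≤c = ℚₚ.*-monoʳ-≤-nonNeg c {{nonNegative 0≤c}}

*-nonneg : ∀ {a b} → 0ℚ ≤ a → 0ℚ ≤ b → 0ℚ ≤ a * b
*-nonneg {a} {b} 0≤a 0≤b = subst (_≤ a * b) (ℚₚ.*-zeroʳ a) (*-monoˡ-≤ 0≤a 0≤b)

square-nonneg : ∀ z → 0ℚ ≤ z * z
square-nonneg z with ℚₚ.≤-total 0ℚ z
... | inj₁ 0≤z = *-nonneg 0≤z 0≤z
... | inj₂ z≤0 = ℚₚ.nonNegative⁻¹ (z * z)
  {{ℚₚ.nonPos*nonPos⇒nonPos z {{Data.Rational.nonPositive z≤0}} z {{Data.Rational.nonPositive z≤0}}}}

p≤p+q : ∀ {p q} → 0ℚ ≤ q → p ≤ p + q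
p≤p+q {p} 0≤q = subst (_≤ p + _) (ℚₚ.+-identityʳ p) (ℚₚ.+-monoʳ-≤ p 0≤q)

-- The arithmetic–geometric mean inequality 2|y| ≤ q y² + r for q r = 1,
-- r ≥ 0: the difference is r (q|y| − 1)².  It bounds the large-frequency
-- part of the error by its second moment.
am-gm : ∀ q r y → q * r ≡ 1ℚ → 0ℚ ≤ r → ∣ y ∣ ≤ (q * (y * y) + r) * ½
am-gm q r y qr≡1 0≤r = begin
  a                                       ≡⟨ halve a ⟨
  (a + a) * ½                             ≤⟨ *-monoʳ-≤ (ℚₚ.nonNegative⁻¹ ½) twice ⟩
  (q * (a * a) + r) * ½                   ≡⟨ cong (λ x → (q * x + r) * ½) abs-square ⟩
  (q * (y * y) + r) * ½                   ∎
  where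
  open ℚₚ.≤-Reasoning
  a : ℚ
  a = ∣ y ∣
  abs-square : a * a ≡ y * y
  abs-square = trans (sym (ℚₚ.∣p*q∣≡∣p∣*∣q∣ y y)) (ℚₚ.0≤p⇒∣p∣≡p (square-nonneg y))
  halve : ∀ (a : ℚ) → (a + a) * ½ ≡ a
  halve = solve-∀ ℚ-ring
  identity : ∀ q r a → a + a + r * ((q * a - 1ℚ) * (q * a - 1ℚ)) + (1ℚ - q * r) * (q * (a * a) - (a + a))
                       ≡ q * (a * a) + r
  identity = solve-∀ ℚ-ring
  drop-zero : ∀ (u v : ℚ) → u + (1ℚ - 1ℚ) * v ≡ u
  drop-zero = solve-∀ ℚ-ring
  twice : a + a ≤ q * (a * a) + r
  twice = begin
    a + a                                                  ≤⟨ p≤p+q {a + a} (*-nonneg 0≤r (square-nonneg (q * a - 1ℚ))) ⟩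
    a + a + r * ((q * a - 1ℚ) * (q * a - 1ℚ))              ≡⟨ drop-zero _ (q * (a * a) - (a + a)) ⟨
    a + a + r * ((q * a - 1ℚ) * (q * a - 1ℚ)) + (1ℚ - 1ℚ) * (q * (a * a) - (a + a))
                                                           ≡⟨ cong (λ t → a + a + r * ((q * a - 1ℚ) * (q * a - 1ℚ)) + (1ℚ - t) * (q * (a * a) - (a + a))) qr≡1 ⟨
    a + a + r * ((q * a - 1ℚ) * (q * a - 1ℚ)) + (1ℚ - q * r) * (q * (a * a) - (a + a))
                                                           ≡⟨ identity q r a ⟩
    q * (a * a) + r                                        ∎

iverson : Bool → ℚ
iverson b = if b then 1ℚ else 0ℚ

iverson-nonneg : ∀ b → 0ℚ ≤ iverson b
iverson-nonneg true  = ℚₚ.nonNegative⁻¹ 1ℚ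
iverson-nonneg false = ℚₚ.≤-refl

iverson-≤1 : ∀ b → iverson b ≤ 1ℚ
iverson-≤1 true  = ℚₚ.≤-refl
iverson-≤1 false = ℚₚ.nonNegative⁻¹ 1ℚ

iverson-idem : ∀ b → iverson b * iverson b ≡ iverson b
iverson-idem true  = refl
iverson-idem false = refl

iverson-∧ : ∀ a b → iverson (a ∧ b) ≡ iverson a * iverson b
iverson-∧ true  b = sym (ℚₚ.*-identityˡ (iverson b))
iverson-∧ false b = sym (ℚₚ.*-zeroˡ (iverson b))

iverson-abs : ∀ b → ∣ iverson b ∣ ≡ iverson b
iverson-abs true  = refl
iverson-abs false = refl

ind-refl : ∀ {m} (a : Fin m) → ind a a ≡ 1ℚ
ind-refl a with a ≟ a
... | yes _ = refl
... | no a≢a = ⊥-elim (a≢a refl)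

ind-≢ : ∀ {m} {a b : Fin m} → ¬ a ≡ b → ind a b ≡ 0ℚ
ind-≢ {a = a} {b} a≢b with a ≟ b
... | yes a≡b = ⊥-elim (a≢b a≡b)
... | no _ = refl

ind-sym : ∀ {m} (a b : Fin m) → ind a b ≡ ind b a
ind-sym a b with a ≟ b | b ≟ a
... | yes _   | yes _   = refl
... | no _    | no _    = refl
... | yes a≡b | no b≢a  = ⊥-elim (b≢a (sym a≡b))
... | no a≢b  | yes b≡a = ⊥-elim (a≢b (sym b≡a))

flipSign : Fin 2 → Fin 2
flipSign zero    = suc zero
flipSign (suc _) = zero

sgn-abs : ∀ t → ∣ sgn t ∣ ≡ 1ℚ
sgn-abs zero       = refl
sgn-abs (suc zero) = refl

sgn-square : ∀ t → sgn t * sgn t ≡ 1ℚ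
sgn-square zero       = refl
sgn-square (suc zero) = refl

sgn-flip : ∀ t → ∣ sgn t - sgn (flipSign t) ∣ ≡ fromℕ 2
sgn-flip zero       = refl
sgn-flip (suc zero) = refl

sumFin-cong : ∀ m {g g' : Fin m → ℚ} → (∀ k → g k ≡ g' k) → sumFin m g ≡ sumFin m g'
sumFin-cong zero    eq = refl
sumFin-cong (suc m) eq = cong₂ _+_ (eq zero) (sumFin-cong m (λ k → eq (suc k)))

sumFin-+ : ∀ m (g g' : Fin m → ℚ) → sumFin m (λ k → g k + g' k) ≡ sumFin m g + sumFin m g'
sumFin-+ zero    g g' = refl
sumFin-+ (suc m) g g' =
  trans (cong ((g zero + g' zero) +_) (sumFin-+ m _ _)) (interchange (g zero) (g' zero) _ _)
  where
  interchange : ∀ (a b c d : ℚ) → a + b + (c + d) ≡ a + c + (b + d)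
  interchange = solve-∀ ℚ-ring

sumFin-- : ∀ m (g g' : Fin m → ℚ) → sumFin m (λ k → g k - g' k) ≡ sumFin m g - sumFin m g'
sumFin-- zero    g g' = refl
sumFin-- (suc m) g g' =
  trans (cong ((g zero - g' zero) +_) (sumFin-- m _ _)) (interchange (g zero) (g' zero) _ _)
  where
  interchange : ∀ (a b c d : ℚ) → a - b + (c - d) ≡ a + c - (b + d)
  interchange = solve-∀ ℚ-ring

sumFin-* : ∀ m (c : ℚ) (g : Fin m → ℚ) → sumFin m (λ k → c * g k) ≡ c * sumFin m g
sumFin-* zero    c g = sym (ℚₚ.*-zeroʳ c)
sumFin-* (suc m) c g = trans (cong (c * g zero +_) (sumFin-* m c _)) (sym (ℚₚ.*-distribˡ-+ c _ _))

sumFin-const : ∀ m (c : ℚ) → sumFin m (λ _ → c) ≡ fromℕ m * c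
sumFin-const zero    c = sym (ℚₚ.*-zeroˡ c)
sumFin-const (suc m) c = begin
  c + sumFin m (λ _ → c)  ≡⟨ cong (c +_) (sumFin-const m c) ⟩
  c + fromℕ m * c         ≡⟨ factor c (fromℕ m) ⟩
  (1ℚ + fromℕ m) * c      ≡⟨ cong (_* c) (fromℕ-+ 1 m) ⟨
  fromℕ (suc m) * c       ∎
  where
  open ≡-Reasoning
  factor : ∀ (c q : ℚ) → c + q * c ≡ (1ℚ + q) * c
  factor = solve-∀ ℚ-ring

sumFin-0 : ∀ m → sumFin m (λ _ → 0ℚ) ≡ 0ℚ
sumFin-0 m = trans (sumFin-const m 0ℚ) (ℚₚ.*-zeroʳ (fromℕ m))

sumFin-mono : ∀ m {g g' : Fin m → ℚ} → (∀ k → g k ≤ g' k) → sumFin m g ≤ sumFin m g'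
sumFin-mono zero    le = ℚₚ.≤-refl
sumFin-mono (suc m) le = ℚₚ.+-mono-≤ (le zero) (sumFin-mono m (λ k → le (suc k)))

sumFin-nonneg : ∀ m {g : Fin m → ℚ} → (∀ k → 0ℚ ≤ g k) → 0ℚ ≤ sumFin m g
sumFin-nonneg m {g} le = subst (_≤ sumFin m g) (sumFin-0 m) (sumFin-mono m le)

sumFin-nonpos : ∀ m {g : Fin m → ℚ} → (∀ k → g k ≤ 0ℚ) → sumFin m g ≤ 0ℚ
sumFin-nonpos m {g} le = subst (sumFin m g ≤_) (sumFin-0 m) (sumFin-mono m le)

sumFin-swap : ∀ m m' (F : Fin m → Fin m' → ℚ) →
  sumFin m (λ a → sumFin m' (F a)) ≡ sumFin m' (λ b → sumFin m (λ a → F a b))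
sumFin-swap zero    m' F = sym (sumFin-0 m')
sumFin-swap (suc m) m' F =
  trans (cong (sumFin m' (F zero) +_) (sumFin-swap m m' (λ a → F (suc a))))
        (sym (sumFin-+ m' (F zero) (λ b → sumFin m (λ a → F (suc a) b))))

sumFin-abs : ∀ m (g : Fin m → ℚ) → ∣ sumFin m g ∣ ≤ sumFin m (λ k → ∣ g k ∣)
sumFin-abs zero    g = ℚₚ.≤-refl
sumFin-abs (suc m) g = ℚₚ.≤-trans (ℚₚ.∣p+q∣≤∣p∣+∣q∣ (g zero) _)
                                  (ℚₚ.+-monoʳ-≤ ∣ g zero ∣ (sumFin-abs m (λ k → g (suc k))))

sumFin-sift : ∀ m (i : Fin m) (g : Fin m → ℚ) → sumFin m (λ j → ind j i * g j) ≡ g i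
sumFin-sift (suc m) zero g = begin
  1ℚ * g zero + sumFin m (λ k → 0ℚ * g (suc k))  ≡⟨ cong (1ℚ * g zero +_) (sumFin-cong m (λ k → ℚₚ.*-zeroˡ (g (suc k)))) ⟩
  1ℚ * g zero + sumFin m (λ _ → 0ℚ)              ≡⟨ cong (1ℚ * g zero +_) (sumFin-0 m) ⟩
  1ℚ * g zero + 0ℚ                               ≡⟨ ℚₚ.+-identityʳ _ ⟩
  1ℚ * g zero                                    ≡⟨ ℚₚ.*-identityˡ _ ⟩
  g zero                                         ∎
  where open ≡-Reasoning
sumFin-sift (suc m) (suc i) g =
  trans (cong (_+ sumFin m (λ k → ind k i * g (suc k))) (ℚₚ.*-zeroˡ (g zero)))
        (trans (ℚₚ.+-identityˡ _) (sumFin-sift m i (λ k → g (suc k))))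

sumFin-product : ∀ m m' (g : Fin m → ℚ) (g' : Fin m' → ℚ) →
  sumFin m g * sumFin m' g' ≡ sumFin m (λ j → sumFin m' (λ k → g j * g' k))
sumFin-product m m' g g' = begin
  sumFin m g * sumFin m' g'                          ≡⟨ ℚₚ.*-comm (sumFin m g) _ ⟩
  sumFin m' g' * sumFin m g                          ≡⟨ sumFin-* m (sumFin m' g') g ⟨
  sumFin m (λ j → sumFin m' g' * g j)                ≡⟨ sumFin-cong m (λ j → ℚₚ.*-comm (sumFin m' g') (g j)) ⟩
  sumFin m (λ j → g j * sumFin m' g')                ≡⟨ sumFin-cong m (λ j → sumFin-* m' (g j) g') ⟨
  sumFin m (λ j → sumFin m' (λ k → g j * g' k))      ∎
  where open ≡-Reasoning

sumFuns-cong : ∀ n m {F G : (Fin n → Fin m) → ℚ} → (∀ g → F g ≡ G g) → sumFuns n m F ≡ sumFuns n m G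
sumFuns-cong zero    m eq = eq _
sumFuns-cong (suc n) m eq = sumFin-cong m (λ a → sumFuns-cong n m (λ g → eq (cons a g)))

sumFuns-+ : ∀ n m (F G : (Fin n → Fin m) → ℚ) →
  sumFuns n m (λ g → F g + G g) ≡ sumFuns n m F + sumFuns n m G
sumFuns-+ zero    m F G = refl
sumFuns-+ (suc n) m F G = trans (sumFin-cong m (λ a → sumFuns-+ n m _ _)) (sumFin-+ m _ _)

sumFuns-- : ∀ n m (F G : (Fin n → Fin m) → ℚ) →
  sumFuns n m (λ g → F g - G g) ≡ sumFuns n m F - sumFuns n m G
sumFuns-- zero    m F G = refl
sumFuns-- (suc n) m F G = trans (sumFin-cong m (λ a → sumFuns-- n m _ _)) (sumFin-- m _ _)

sumFuns-* : ∀ n m (c : ℚ) (F : (Fin n → Fin m) → ℚ) → sumFuns n m (λ g → c * F g) ≡ c * sumFuns n m F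
sumFuns-* zero    m c F = refl
sumFuns-* (suc n) m c F = trans (sumFin-cong m (λ a → sumFuns-* n m c _)) (sumFin-* m c _)

spare-coordinate : ∀ m n (S : ℚ) →
  sumFin m (λ _ → fromℕ (m Nat.^ n) * S) ≡ fromℕ (m Nat.^ suc n) * S
spare-coordinate m n S = begin
  sumFin m (λ _ → fromℕ (m Nat.^ n) * S)  ≡⟨ sumFin-const m _ ⟩
  fromℕ m * (fromℕ (m Nat.^ n) * S)       ≡⟨ ℚₚ.*-assoc (fromℕ m) _ S ⟨
  fromℕ m * fromℕ (m Nat.^ n) * S         ≡⟨ cong (_* S) (fromℕ-* m (m Nat.^ n)) ⟨
  fromℕ (m Nat.^ suc n) * S               ∎
  where open ≡-Reasoning

sumFuns-const : ∀ n m (c : ℚ) → sumFuns n m (λ _ → c) ≡ fromℕ (m Nat.^ n) * c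
sumFuns-const zero    m c = sym (ℚₚ.*-identityˡ c)
sumFuns-const (suc n) m c =
  trans (sumFin-cong m (λ _ → sumFuns-const n m c)) (spare-coordinate m n c)

sumFuns-0 : ∀ n m → sumFuns n m (λ _ → 0ℚ) ≡ 0ℚ
sumFuns-0 n m = trans (sumFuns-const n m 0ℚ) (ℚₚ.*-zeroʳ (fromℕ (m Nat.^ n)))

sumFuns-mono : ∀ n m {F G : (Fin n → Fin m) → ℚ} → (∀ g → F g ≤ G g) → sumFuns n m F ≤ sumFuns n m G
sumFuns-mono zero    m le = le _
sumFuns-mono (suc n) m le = sumFin-mono m (λ a → sumFuns-mono n m (λ g → le (cons a g)))

sumFuns-nonneg : ∀ n m {F : (Fin n → Fin m) → ℚ} → (∀ g → 0ℚ ≤ F g) → 0ℚ ≤ sumFuns n m F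
sumFuns-nonneg n m {F} le = subst (_≤ sumFuns n m F) (sumFuns-0 n m) (sumFuns-mono n m le)

sumFuns-sumFin : ∀ n m k (F : Fin k → (Fin n → Fin m) → ℚ) →
  sumFuns n m (λ g → sumFin k (λ j → F j g)) ≡ sumFin k (λ j → sumFuns n m (F j))
sumFuns-sumFin n m zero    F = sumFuns-0 n m
sumFuns-sumFin n m (suc k) F = trans (sumFuns-+ n m (F zero) _)
  (cong (sumFuns n m (F zero) +_) (sumFuns-sumFin n m k (λ j → F (suc j))))

-- Summing over all g : Fin n' → Fin m a quantity that depends
-- only on one, two or three distinct values of g factors as m^(n'−1),
-- m^(n'−2), m^(n'−3) times the corresponding sum over the values: the
-- coordinates of a uniformly random function are independent and uniform.
sumFuns-one : ∀ n m (k : Fin (suc n)) (φ : Fin m → ℚ) →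
  sumFuns (suc n) m (λ g → φ (g k)) ≡ fromℕ (m Nat.^ n) * sumFin m φ
sumFuns-one n       m zero    φ =
  trans (sumFin-cong m (λ a → sumFuns-const n m (φ a))) (sumFin-* m (fromℕ (m Nat.^ n)) φ)
sumFuns-one (suc n) m (suc k) φ =
  trans (sumFin-cong m (λ _ → sumFuns-one n m k φ)) (spare-coordinate m n (sumFin m φ))

sumFuns-two : ∀ n m (j k : Fin (suc (suc n))) → ¬ j ≡ k → (Φ : Fin m → Fin m → ℚ) →
  sumFuns (suc (suc n)) m (λ g → Φ (g j) (g k)) ≡ fromℕ (m Nat.^ n) * sumFin m (λ a → sumFin m (Φ a))
sumFuns-two n m zero zero j≢k Φ = ⊥-elim (j≢k refl)
sumFuns-two n m zero (suc k) j≢k Φ =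
  trans (sumFin-cong m (λ a → sumFuns-one n m k (Φ a))) (sumFin-* m (fromℕ (m Nat.^ n)) (λ a → sumFin m (Φ a)))
sumFuns-two n m (suc j) zero j≢k Φ =
  trans (sumFin-cong m (λ b → sumFuns-one n m j (λ a → Φ a b)))
  (trans (sumFin-* m (fromℕ (m Nat.^ n)) (λ b → sumFin m (λ a → Φ a b)))
         (cong (fromℕ (m Nat.^ n) *_) (sumFin-swap m m (λ b a → Φ a b))))
sumFuns-two zero m (suc zero) (suc zero) j≢k Φ = ⊥-elim (j≢k refl)
sumFuns-two (suc n) m (suc j) (suc k) j≢k Φ =
  trans (sumFin-cong m (λ _ → sumFuns-two n m j k (λ e → j≢k (cong suc e)) Φ))
        (spare-coordinate m n (sumFin m (λ a → sumFin m (Φ a))))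

sumFuns-three : ∀ n m (j k l : Fin (suc (suc (suc n)))) → ¬ j ≡ k → ¬ j ≡ l → ¬ k ≡ l →
  (Φ : Fin m → Fin m → Fin m → ℚ) →
  sumFuns (suc (suc (suc n))) m (λ g → Φ (g j) (g k) (g l))
    ≡ fromℕ (m Nat.^ n) * sumFin m (λ a → sumFin m (λ b → sumFin m (Φ a b)))
sumFuns-three n m zero zero l j≢k j≢l k≢l Φ = ⊥-elim (j≢k refl)
sumFuns-three n m zero k zero j≢k j≢l k≢l Φ = ⊥-elim (j≢l refl)
sumFuns-three n m j zero zero j≢k j≢l k≢l Φ = ⊥-elim (k≢l refl)
sumFuns-three n m zero (suc k) (suc l) j≢k j≢l k≢l Φ =
  trans (sumFin-cong m (λ a → sumFuns-two n m k l (λ e → k≢l (cong suc e)) (Φ a)))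
        (sumFin-* m (fromℕ (m Nat.^ n)) _)
sumFuns-three n m (suc j) zero (suc l) j≢k j≢l k≢l Φ =
  trans (sumFin-cong m (λ b → sumFuns-two n m j l (λ e → j≢l (cong suc e)) (λ a c → Φ a b c)))
  (trans (sumFin-* m (fromℕ (m Nat.^ n)) _)
         (cong (fromℕ (m Nat.^ n) *_) (sumFin-swap m m (λ b a → sumFin m (Φ a b)))))
sumFuns-three n m (suc j) (suc k) zero j≢k j≢l k≢l Φ =
  trans (sumFin-cong m (λ c → sumFuns-two n m j k (λ e → j≢k (cong suc e)) (λ a b → Φ a b c)))
  (trans (sumFin-* m (fromℕ (m Nat.^ n)) _) (cong (fromℕ (m Nat.^ n) *_)
    (trans (sumFin-swap m m (λ c a → sumFin m (λ b → Φ a b c)))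
           (sumFin-cong m (λ a → sumFin-swap m m (λ c b → Φ a b c))))))
sumFuns-three zero m (suc zero) (suc zero) l j≢k j≢l k≢l Φ = ⊥-elim (j≢k refl)
sumFuns-three zero m (suc zero) (suc (suc zero)) (suc zero) j≢k j≢l k≢l Φ = ⊥-elim (j≢l refl)
sumFuns-three zero m (suc zero) (suc (suc zero)) (suc (suc zero)) j≢k j≢l k≢l Φ = ⊥-elim (k≢l refl)
sumFuns-three zero m (suc (suc zero)) (suc zero) (suc zero) j≢k j≢l k≢l Φ = ⊥-elim (k≢l refl)
sumFuns-three zero m (suc (suc zero)) (suc zero) (suc (suc zero)) j≢k j≢l k≢l Φ = ⊥-elim (j≢l refl)
sumFuns-three zero m (suc (suc zero)) (suc (suc zero)) l j≢k j≢l k≢l Φ = ⊥-elim (j≢k refl)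
sumFuns-three (suc n) m (suc j) (suc k) (suc l) j≢k j≢l k≢l Φ =
  trans (sumFin-cong m (λ _ → sumFuns-three n m j k l (λ e → j≢k (cong suc e))
                                (λ e → j≢l (cong suc e)) (λ e → k≢l (cong suc e)) Φ))
        (spare-coordinate m n (sumFin m (λ a → sumFin m (λ b → sumFin m (Φ a b)))))

diagonal-count : ∀ m → sumFin m (λ a → sumFin m (λ b → ind a b)) ≡ fromℕ m
diagonal-count m = begin
  sumFin m (λ a → sumFin m (λ b → ind a b))        ≡⟨ sumFin-cong m (λ a → sumFin-cong m (λ b → ind-sym a b)) ⟩
  sumFin m (λ a → sumFin m (λ b → ind b a))        ≡⟨ sumFin-cong m (λ a → sumFin-cong m (λ b → ℚₚ.*-identityʳ (ind b a))) ⟨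
  sumFin m (λ a → sumFin m (λ b → ind b a * 1ℚ))   ≡⟨ sumFin-cong m (λ a → sumFin-sift m a (λ _ → 1ℚ)) ⟩
  sumFin m (λ _ → 1ℚ)                              ≡⟨ sumFin-const m 1ℚ ⟩
  fromℕ m * 1ℚ                                     ≡⟨ ℚₚ.*-identityʳ (fromℕ m) ⟩
  fromℕ m                                          ∎
  where open ≡-Reasoning

triple-diagonal-count : ∀ m → sumFin m (λ a → sumFin m (λ b → sumFin m (λ c → ind a c * ind b c))) ≡ fromℕ m
triple-diagonal-count m = begin
  sumFin m (λ a → sumFin m (λ b → sumFin m (λ c → ind a c * ind b c)))
    ≡⟨ sumFin-cong m (λ a → sumFin-cong m (λ b → sumFin-cong m (λ c → cong (_* ind b c) (ind-sym a c)))) ⟩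
  sumFin m (λ a → sumFin m (λ b → sumFin m (λ c → ind c a * ind b c)))
    ≡⟨ sumFin-cong m (λ a → sumFin-cong m (λ b → sumFin-sift m a (ind b))) ⟩
  sumFin m (λ a → sumFin m (λ b → ind b a))
    ≡⟨ sumFin-swap m m (λ a b → ind b a) ⟩
  sumFin m (λ b → sumFin m (λ a → ind b a))
    ≡⟨ diagonal-count m ⟩
  fromℕ m
    ∎
  where open ≡-Reasoning

power-recip : ∀ b n → fromℕ (suc b Nat.^ suc n) * recip b ≡ fromℕ (suc b Nat.^ n)
power-recip b n = begin
  fromℕ (B Nat.* B Nat.^ n) * recip b         ≡⟨ cong (_* recip b) (fromℕ-* B (B Nat.^ n)) ⟩
  fromℕ B * fromℕ (B Nat.^ n) * recip b       ≡⟨ rearrange (fromℕ B) _ (recip b) ⟩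
  fromℕ B * recip b * fromℕ (B Nat.^ n)       ≡⟨ cong (_* fromℕ (B Nat.^ n)) (recip-inverse b) ⟩
  1ℚ * fromℕ (B Nat.^ n)                      ≡⟨ ℚₚ.*-identityˡ _ ⟩
  fromℕ (B Nat.^ n)                           ∎
  where
  open ≡-Reasoning
  B : ℕ
  B = suc b
  rearrange : ∀ (q p r : ℚ) → q * p * r ≡ q * r * p
  rearrange = solve-∀ ℚ-ring

pair-collisions : ∀ b n (j i : Fin n) → ¬ j ≡ i →
  sumFuns n (suc b) (λ h → ind (h j) (h i)) ≡ fromℕ (suc b Nat.^ n) * recip b
pair-collisions b (suc zero) zero zero j≢i = ⊥-elim (j≢i refl)
pair-collisions b (suc (suc n)) j i j≢i = begin
  sumFuns (suc (suc n)) B (λ h → ind (h j) (h i))     ≡⟨ sumFuns-two n B j i j≢i ind ⟩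
  fromℕ (B Nat.^ n) * sumFin B (λ a → sumFin B (ind a)) ≡⟨ cong (fromℕ (B Nat.^ n) *_) (diagonal-count B) ⟩
  fromℕ (B Nat.^ n) * fromℕ B                         ≡⟨ ℚₚ.*-comm _ (fromℕ B) ⟩
  fromℕ B * fromℕ (B Nat.^ n)                         ≡⟨ fromℕ-* B (B Nat.^ n) ⟨
  fromℕ (B Nat.^ suc n)                               ≡⟨ power-recip b (suc n) ⟨
  fromℕ (B Nat.^ suc (suc n)) * recip b               ∎
  where
  open ≡-Reasoning
  B : ℕ
  B = suc b

triple-collisions : ∀ b n (j k i : Fin n) → ¬ j ≡ k → ¬ j ≡ i → ¬ k ≡ i →
  sumFuns n (suc b) (λ h → ind (h j) (h i) * ind (h k) (h i)) ≡ fromℕ (suc b Nat.^ n) * (recip b * recip b)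
triple-collisions b (suc zero) zero zero i j≢k _ _ = ⊥-elim (j≢k refl)
triple-collisions b (suc (suc zero)) zero zero i j≢k _ _ = ⊥-elim (j≢k refl)
triple-collisions b (suc (suc zero)) zero (suc zero) zero _ j≢i _ = ⊥-elim (j≢i refl)
triple-collisions b (suc (suc zero)) zero (suc zero) (suc zero) _ _ k≢i = ⊥-elim (k≢i refl)
triple-collisions b (suc (suc zero)) (suc zero) zero zero _ _ k≢i = ⊥-elim (k≢i refl)
triple-collisions b (suc (suc zero)) (suc zero) zero (suc zero) _ j≢i _ = ⊥-elim (j≢i refl)
triple-collisions b (suc (suc zero)) (suc zero) (suc zero) i j≢k _ _ = ⊥-elim (j≢k refl)
triple-collisions b (suc (suc (suc n))) j k i j≢k j≢i k≢i = begin
  sumFuns (suc (suc (suc n))) B (λ h → ind (h j) (h i) * ind (h k) (h i))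
    ≡⟨ sumFuns-three n B j k i j≢k j≢i k≢i (λ x y z → ind x z * ind y z) ⟩
  fromℕ (B Nat.^ n) * sumFin B (λ a → sumFin B (λ b' → sumFin B (λ c → ind a c * ind b' c)))
    ≡⟨ cong (fromℕ (B Nat.^ n) *_) (triple-diagonal-count B) ⟩
  fromℕ (B Nat.^ n) * fromℕ B
    ≡⟨ ℚₚ.*-comm _ (fromℕ B) ⟩
  fromℕ B * fromℕ (B Nat.^ n)
    ≡⟨ fromℕ-* B (B Nat.^ n) ⟨
  fromℕ (B Nat.^ suc n)
    ≡⟨ power-recip b (suc n) ⟨
  fromℕ (B Nat.^ suc (suc n)) * recip b
    ≡⟨ cong (_* recip b) (power-recip b (suc (suc n))) ⟨
  fromℕ (B Nat.^ suc (suc (suc n))) * recip b * recip b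
    ≡⟨ ℚₚ.*-assoc (fromℕ (B Nat.^ suc (suc (suc n)))) (recip b) (recip b) ⟩
  fromℕ (B Nat.^ suc (suc (suc n))) * (recip b * recip b)
    ∎
  where
  open ≡-Reasoning
  B : ℕ
  B = suc b

sign-correlation : ∀ n (j k : Fin n) →
  sumFuns n 2 (λ s → sgn (s j) * sgn (s k)) ≡ fromℕ (2 Nat.^ n) * ind k j
sign-correlation n j k with j ≟ k
... | yes refl = begin
  sumFuns n 2 (λ s → sgn (s j) * sgn (s j))   ≡⟨ sumFuns-cong n 2 (λ s → sgn-square (s j)) ⟩
  sumFuns n 2 (λ _ → 1ℚ)                      ≡⟨ sumFuns-const n 2 1ℚ ⟩
  fromℕ (2 Nat.^ n) * 1ℚ                      ≡⟨ cong (fromℕ (2 Nat.^ n) *_) (ind-refl j) ⟨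
  fromℕ (2 Nat.^ n) * ind j j                 ∎
  where open ≡-Reasoning
... | no j≢k = trans (uncorrelated n j k j≢k) (cong (fromℕ (2 Nat.^ n) *_) (sym (ind-≢ (λ e → j≢k (sym e)))))
  where
  uncorrelated : ∀ n (j k : Fin n) → ¬ j ≡ k → sumFuns n 2 (λ s → sgn (s j) * sgn (s k)) ≡ fromℕ (2 Nat.^ n) * 0ℚ
  uncorrelated (suc zero)    zero zero j≢k = ⊥-elim (j≢k refl)
  uncorrelated (suc (suc n)) j    k    j≢k =
    trans (sumFuns-two n 2 j k j≢k (λ a b → sgn a * sgn b))
          (trans (ℚₚ.*-zeroʳ (fromℕ (2 Nat.^ n))) (sym (ℚₚ.*-zeroʳ (fromℕ (2 Nat.^ suc (suc n))))))

flipSignAt : ∀ {n} → Fin n → (Fin n → Fin 2) → Fin n → Fin 2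
flipSignAt zero    s = cons (flipSign (s zero)) (λ x → s (suc x))
flipSignAt (suc j) s = cons (s zero) (flipSignAt j (λ x → s (suc x)))

flipSignAt-here : ∀ {n} (j : Fin n) s → flipSignAt j s j ≡ flipSign (s j)
flipSignAt-here zero    s = refl
flipSignAt-here (suc j) s = flipSignAt-here j (λ x → s (suc x))

flipSignAt-elsewhere : ∀ {n} (j k : Fin n) s → ¬ j ≡ k → flipSignAt j s k ≡ s k
flipSignAt-elsewhere zero    zero    s j≢k = ⊥-elim (j≢k refl)
flipSignAt-elsewhere zero    (suc k) s j≢k = refl
flipSignAt-elsewhere (suc j) zero    s j≢k = refl
flipSignAt-elsewhere (suc j) (suc k) s j≢k = flipSignAt-elsewhere j k (λ x → s (suc x)) (λ e → j≢k (cong suc e))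

sumFuns-flipSignAt : ∀ n (j : Fin n) (F : (Fin n → Fin 2) → ℚ) →
  sumFuns n 2 (λ s → F (flipSignAt j s)) ≡ sumFuns n 2 F
sumFuns-flipSignAt (suc n) zero F = swap (sumFuns n 2 (λ g → F (cons zero g))) (sumFuns n 2 (λ g → F (cons (suc zero) g)))
  where
  swap : ∀ (x y : ℚ) → y + (x + 0ℚ) ≡ x + (y + 0ℚ)
  swap = solve-∀ ℚ-ring
sumFuns-flipSignAt (suc n) (suc j) F = sumFin-cong 2 (λ a → sumFuns-flipSignAt n j (λ g → F (cons a g)))

sumℕ : ℕ → (ℕ → ℚ) → ℚ
sumℕ zero    φ = 0ℚ
sumℕ (suc m) φ = φ 0 + sumℕ m (λ k → φ (suc k))

sumFin-toℕ : ∀ m (φ : ℕ → ℚ) → sumFin m (λ j → φ (toℕ j)) ≡ sumℕ m φ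
sumFin-toℕ zero    φ = refl
sumFin-toℕ (suc m) φ = cong (φ 0 +_) (sumFin-toℕ m (λ k → φ (suc k)))

sumℕ-cong : ∀ m {φ ψ : ℕ → ℚ} → (∀ k → k Nat.< m → φ k ≡ ψ k) → sumℕ m φ ≡ sumℕ m ψ
sumℕ-cong zero    eq = refl
sumℕ-cong (suc m) eq = cong₂ _+_ (eq 0 (s≤s z≤n)) (sumℕ-cong m (λ k k<m → eq (suc k) (s≤s k<m)))

sumℕ-mono : ∀ m {φ ψ : ℕ → ℚ} → (∀ k → k Nat.< m → φ k ≤ ψ k) → sumℕ m φ ≤ sumℕ m ψ
sumℕ-mono zero    le = ℚₚ.≤-refl
sumℕ-mono (suc m) le = ℚₚ.+-mono-≤ (le 0 (s≤s z≤n)) (sumℕ-mono m (λ k k<m → le (suc k) (s≤s k<m)))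

sumℕ-split : ∀ a len (φ : ℕ → ℚ) → sumℕ (a Nat.+ len) φ ≡ sumℕ a φ + sumℕ len (λ j → φ (a Nat.+ j))
sumℕ-split zero    len φ = sym (ℚₚ.+-identityˡ _)
sumℕ-split (suc a) len φ =
  trans (cong (φ 0 +_) (sumℕ-split a len (λ j → φ (suc j)))) (sym (ℚₚ.+-assoc (φ 0) _ _))

sumℕ-const : ∀ m (c : ℚ) → sumℕ m (λ _ → c) ≡ fromℕ m * c
sumℕ-const m c = trans (sym (sumFin-toℕ m (λ _ → c))) (sumFin-const m c)

sumℕ-nonneg : ∀ m {φ : ℕ → ℚ} → (∀ k → 0ℚ ≤ φ k) → 0ℚ ≤ sumℕ m φ
sumℕ-nonneg m {φ} 0≤φ = subst (_≤ sumℕ m φ) (trans (sumℕ-const m 0ℚ) (ℚₚ.*-zeroʳ (fromℕ m)))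
                              (sumℕ-mono m (λ k _ → 0≤φ k))

<ᵇ-true : ∀ {k b} → k Nat.< b → (k <ᵇ b) ≡ true
<ᵇ-true {zero}  (s≤s _)   = refl
<ᵇ-true {suc k} (s≤s k<b) = <ᵇ-true k<b

<ᵇ-false : ∀ b j → ((b Nat.+ j) <ᵇ b) ≡ false
<ᵇ-false zero    j = refl
<ᵇ-false (suc b) j = <ᵇ-false b j

<ᵇ-irrefl : ∀ k → (k <ᵇ k) ≡ false
<ᵇ-irrefl zero    = refl
<ᵇ-irrefl (suc k) = <ᵇ-irrefl k

sumℕ-below : ∀ b len (φ : ℕ → ℚ) → sumℕ (b Nat.+ len) (λ k → iverson (k <ᵇ b) * φ k) ≡ sumℕ b φ
sumℕ-below b len φ = begin
  sumℕ (b Nat.+ len) (λ k → iverson (k <ᵇ b) * φ k)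
    ≡⟨ sumℕ-split b len _ ⟩
  sumℕ b (λ k → iverson (k <ᵇ b) * φ k) + sumℕ len (λ j → iverson ((b Nat.+ j) <ᵇ b) * φ (b Nat.+ j))
    ≡⟨ cong₂ _+_ (sumℕ-cong b (λ k k<b → trans (cong (λ t → iverson t * φ k) (<ᵇ-true k<b)) (ℚₚ.*-identityˡ (φ k))))
                 (sumℕ-cong len (λ j _ → trans (cong (λ t → iverson t * φ (b Nat.+ j)) (<ᵇ-false b j)) (ℚₚ.*-zeroˡ (φ (b Nat.+ j))))) ⟩
  sumℕ b φ + sumℕ len (λ _ → 0ℚ)
    ≡⟨ cong (sumℕ b φ +_) (trans (sumℕ-const len 0ℚ) (ℚₚ.*-zeroʳ (fromℕ len))) ⟩
  sumℕ b φ + 0ℚ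
    ≡⟨ ℚₚ.+-identityʳ _ ⟩
  sumℕ b φ
    ∎
  where open ≡-Reasoning

sumℕ-above : ∀ b len (φ : ℕ → ℚ) →
  sumℕ (b Nat.+ len) (λ k → iverson (not (k <ᵇ b)) * φ k) ≡ sumℕ len (λ j → φ (b Nat.+ j))
sumℕ-above b len φ = begin
  sumℕ (b Nat.+ len) (λ k → iverson (not (k <ᵇ b)) * φ k)
    ≡⟨ sumℕ-split b len _ ⟩
  sumℕ b (λ k → iverson (not (k <ᵇ b)) * φ k) + sumℕ len (λ j → iverson (not ((b Nat.+ j) <ᵇ b)) * φ (b Nat.+ j))
    ≡⟨ cong₂ _+_ (sumℕ-cong b (λ k k<b → trans (cong (λ t → iverson (not t) * φ k) (<ᵇ-true k<b)) (ℚₚ.*-zeroˡ (φ k))))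
                 (sumℕ-cong len (λ j _ → trans (cong (λ t → iverson (not t) * φ (b Nat.+ j)) (<ᵇ-false b j)) (ℚₚ.*-identityˡ (φ (b Nat.+ j))))) ⟩
  sumℕ b (λ _ → 0ℚ) + sumℕ len (λ j → φ (b Nat.+ j))
    ≡⟨ cong (_+ sumℕ len (λ j → φ (b Nat.+ j))) (trans (sumℕ-const b 0ℚ) (ℚₚ.*-zeroʳ (fromℕ b))) ⟩
  0ℚ + sumℕ len (λ j → φ (b Nat.+ j))
    ≡⟨ ℚₚ.+-identityˡ _ ⟩
  sumℕ len (λ j → φ (b Nat.+ j))
    ∎
  where open ≡-Reasoning

count-below : ∀ m t → sumℕ m (λ k → iverson (k <ᵇ t)) ≤ fromℕ t
count-below zero    t       = fromℕ-nonneg t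
count-below (suc m) zero    = ℚₚ.≤-reflexive (trans (ℚₚ.+-identityˡ _) (trans (sumℕ-const m 0ℚ) (ℚₚ.*-zeroʳ (fromℕ m))))
count-below (suc m) (suc t) = ℚₚ.≤-trans (ℚₚ.+-monoʳ-≤ 1ℚ (count-below m t)) (ℚₚ.≤-reflexive (sym (fromℕ-+ 1 t)))

harmonic : ℕ → ℚ
harmonic m = sumℕ m recip

harmonic-mono : ∀ {a b} → a ≤ₙ b → harmonic a ≤ harmonic b
harmonic-mono {a} {b} a≤b = begin
  harmonic a                                               ≤⟨ p≤p+q (sumℕ-nonneg (b Nat.∸ a) (λ k → recip-nonneg (a Nat.+ k))) ⟩
  harmonic a + sumℕ (b Nat.∸ a) (λ k → recip (a Nat.+ k))  ≡⟨ sumℕ-split a (b Nat.∸ a) recip ⟨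
  harmonic (a Nat.+ (b Nat.∸ a))                           ≡⟨ cong harmonic (ℕₚ.m+[n∸m]≡n a≤b) ⟩
  harmonic b                                               ∎
  where open ℚₚ.≤-Reasoning

-- The block 1/(m+1) + … + 1/(2m) of m terms lies between ½ and 1, since each
-- term lies between 1/(2m) and 1/m.  Hence H m + ½ ≤ H (2m) ≤ H m + 1.
block-lower : ∀ m' → ½ ≤ sumℕ (suc m') (λ j → recip (suc m' Nat.+ j))
block-lower m' = begin
  ½                                             ≡⟨ half ⟨
  fromℕ m * recip (m' Nat.+ m)                  ≡⟨ sumℕ-const m _ ⟨
  sumℕ m (λ _ → recip (m' Nat.+ m))             ≤⟨ sumℕ-mono m (λ j j<m → recip-antitone (bound j j<m)) ⟩
  sumℕ m (λ j → recip (m Nat.+ j))              ∎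
  where
  open ℚₚ.≤-Reasoning
  m : ℕ
  m = suc m'
  bound : ∀ j → j Nat.< m → m Nat.+ j ≤ₙ m' Nat.+ m
  bound j (s≤s j≤m') = subst (m Nat.+ j ≤ₙ_) (ℕₚ.+-comm m m') (ℕₚ.+-monoʳ-≤ m j≤m')
  half : fromℕ m * recip (m' Nat.+ m) ≡ ½
  half = trans (/-* m 0 1 (m' Nat.+ m)) (/-≡ (m Nat.* 1) (m' Nat.+ m Nat.+ 0) 1 1 (cross m'))
    where
    cross : ∀ m' → suc m' Nat.* 1 Nat.* 2 ≡ 1 Nat.* suc (m' Nat.+ suc m' Nat.+ 0)
    cross = ℕ-Solver.solve-∀

block-upper : ∀ m' → sumℕ (suc m') (λ j → recip (suc m' Nat.+ j)) ≤ 1ℚ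
block-upper m' = begin
  sumℕ m (λ j → recip (m Nat.+ j))  ≤⟨ sumℕ-mono m (λ j _ → recip-antitone (ℕₚ.≤-trans (ℕₚ.n≤1+n m') (ℕₚ.m≤m+n m j))) ⟩
  sumℕ m (λ _ → recip m')           ≡⟨ sumℕ-const m (recip m') ⟩
  fromℕ m * recip m'                ≡⟨ recip-inverse m' ⟩
  1ℚ                                ∎
  where
  open ℚₚ.≤-Reasoning
  m : ℕ
  m = suc m'

harmonic-double-lower : ∀ m → 1 ≤ₙ m → harmonic m + ½ ≤ harmonic (m Nat.+ m)
harmonic-double-lower (suc m') _ =
  ℚₚ.≤-trans (ℚₚ.+-monoʳ-≤ (harmonic (suc m')) (block-lower m'))
             (ℚₚ.≤-reflexive (sym (sumℕ-split (suc m') (suc m') recip)))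

harmonic-double-upper : ∀ m → harmonic (m Nat.+ m) ≤ harmonic m + 1ℚ
harmonic-double-upper zero     = ℚₚ.nonNegative⁻¹ (0ℚ + 1ℚ)
harmonic-double-upper (suc m') =
  ℚₚ.≤-trans (ℚₚ.≤-reflexive (sumℕ-split (suc m') (suc m') recip))
             (ℚₚ.+-monoʳ-≤ (harmonic (suc m')) (block-upper m'))

private
  2^-suc : ∀ k → 2 Nat.^ suc k ≡ 2 Nat.^ k Nat.+ 2 Nat.^ k
  2^-suc k = cong (2 Nat.^ k Nat.+_) (ℕₚ.+-identityʳ (2 Nat.^ k))

harmonic-pow2-lower : ∀ k → 1ℚ + fromℕ k * ½ ≤ harmonic (2 Nat.^ k)
harmonic-pow2-lower zero    = ℚₚ.≤-refl
harmonic-pow2-lower (suc k) = begin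
  1ℚ + fromℕ (suc k) * ½               ≡⟨ cong (λ x → 1ℚ + x * ½) (fromℕ-+ 1 k) ⟩
  1ℚ + (1ℚ + fromℕ k) * ½              ≡⟨ regroup (fromℕ k) ½ ⟩
  1ℚ + fromℕ k * ½ + ½                 ≤⟨ ℚₚ.+-monoˡ-≤ ½ (harmonic-pow2-lower k) ⟩
  harmonic (2 Nat.^ k) + ½             ≤⟨ harmonic-double-lower (2 Nat.^ k) (ℕₚ.m^n>0 2 k) ⟩
  harmonic (2 Nat.^ k Nat.+ 2 Nat.^ k) ≡⟨ cong harmonic (2^-suc k) ⟨
  harmonic (2 Nat.^ suc k)             ∎
  where
  open ℚₚ.≤-Reasoning
  regroup : ∀ (q h : ℚ) → 1ℚ + (1ℚ + q) * h ≡ 1ℚ + q * h + h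
  regroup = solve-∀ ℚ-ring

harmonic-pow2-upper : ∀ k → harmonic (2 Nat.^ k) ≤ 1ℚ + fromℕ k
harmonic-pow2-upper zero    = ℚₚ.≤-refl
harmonic-pow2-upper (suc k) = begin
  harmonic (2 Nat.^ suc k)             ≡⟨ cong harmonic (2^-suc k) ⟩
  harmonic (2 Nat.^ k Nat.+ 2 Nat.^ k) ≤⟨ harmonic-double-upper (2 Nat.^ k) ⟩
  harmonic (2 Nat.^ k) + 1ℚ            ≤⟨ ℚₚ.+-monoˡ-≤ 1ℚ (harmonic-pow2-upper k) ⟩
  1ℚ + fromℕ k + 1ℚ                    ≡⟨ regroup (fromℕ k) ⟩
  1ℚ + (1ℚ + fromℕ k)                  ≡⟨ cong (1ℚ +_) (fromℕ-+ 1 k) ⟨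
  1ℚ + fromℕ (suc k)                   ∎
  where
  open ℚₚ.≤-Reasoning
  regroup : ∀ (q : ℚ) → 1ℚ + q + 1ℚ ≡ 1ℚ + (1ℚ + q)
  regroup = solve-∀ ℚ-ring

pow2-log-≤ : ∀ B → 1 ≤ₙ B → 2 Nat.^ ⌊log₂ B ⌋ ≤ₙ B
pow2-log-≤ = <-rec (λ B → 1 ≤ₙ B → 2 Nat.^ ⌊log₂ B ⌋ ≤ₙ B) step
  where
  step : ∀ B → (∀ {C} → C Nat.< B → 1 ≤ₙ C → 2 Nat.^ ⌊log₂ C ⌋ ≤ₙ C) → 1 ≤ₙ B → 2 Nat.^ ⌊log₂ B ⌋ ≤ₙ B
  step (suc zero)    _  _ = s≤s z≤n
  step (suc (suc b)) ih _ = begin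
    2 Nat.^ ⌊log₂ B ⌋                       ≡⟨ cong (2 Nat.^_) log-halve ⟩
    2 Nat.^ suc ⌊log₂ h ⌋                   ≡⟨ 2^-suc ⌊log₂ h ⌋ ⟩
    2 Nat.^ ⌊log₂ h ⌋ Nat.+ 2 Nat.^ ⌊log₂ h ⌋ ≤⟨ ℕₚ.+-mono-≤ ih-h ih-h ⟩
    h Nat.+ h                               ≤⟨ ℕₚ.+-monoʳ-≤ h (ℕₚ.⌊n/2⌋≤⌈n/2⌉ B) ⟩
    h Nat.+ Nat.⌈ B /2⌉                     ≡⟨ ℕₚ.⌊n/2⌋+⌈n/2⌉≡n B ⟩
    B                                       ∎
    where
    open ℕₚ.≤-Reasoning
    B : ℕ
    B = suc (suc b)
    h : ℕ
    h = Nat.⌊ B /2⌋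
    ih-h : 2 Nat.^ ⌊log₂ h ⌋ ≤ₙ h
    ih-h = ih (ℕₚ.⌊n/2⌋<n (suc b)) (s≤s z≤n)
    log-halve : ⌊log₂ B ⌋ ≡ suc ⌊log₂ h ⌋
    log-halve = trans (sym (ℕₚ.m+[n∸m]≡n (⌊log₂⌋-mono-≤ {2} {B} (s≤s (s≤s z≤n)))))
                      (cong suc (sym (⌊log₂⌊n/2⌋⌋≡⌊log₂n⌋∸1 B)))

pow2-log-> : ∀ B → B Nat.< 2 Nat.^ suc ⌊log₂ B ⌋
pow2-log-> B with 2 Nat.^ suc ⌊log₂ B ⌋ Nat.≤? B
... | no  2^k+1≰B = ℕₚ.≰⇒> 2^k+1≰B
... | yes 2^k+1≤B = ⊥-elim (ℕₚ.n≮n ⌊log₂ B ⌋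
  (subst (Nat._≤ ⌊log₂ B ⌋) (⌊log₂[2^n]⌋≡n (suc ⌊log₂ B ⌋)) (⌊log₂⌋-mono-≤ 2^k+1≤B)))

harmonic-log : ∀ B → 1 ≤ₙ B →
  (1ℚ + fromℕ ⌊log₂ B ⌋ * ½ ≤ harmonic B) × (harmonic B ≤ 1ℚ + fromℕ (suc ⌊log₂ B ⌋))
harmonic-log B 1≤B =
  ℚₚ.≤-trans (harmonic-pow2-lower ⌊log₂ B ⌋) (harmonic-mono (pow2-log-≤ B 1≤B)) ,
  ℚₚ.≤-trans (harmonic-mono (ℕₚ.<⇒≤ (pow2-log-> B))) (harmonic-pow2-upper (suc ⌊log₂ B ⌋))

-- 1/(a+2)² ≤ 1/(a+1) − 1/(a+2), so the tail of Σ 1/j² telescopes: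
-- Σ_{a+2 ≤ j ≤ a+len+1} 1/j² + 1/(a+len+1) ≤ 1/(a+1).
recip² : ℕ → ℚ
recip² k = recip k * recip k

recip²-step : ∀ a → recip² (suc a) + recip (suc a) ≤ recip a
recip²-step a = begin
  recip² (suc a) + recip (suc a)             ≡⟨ cong (_+ recip (suc a)) (/-* 1 (suc a) 1 (suc a)) ⟩
  ℤ.+ (1 Nat.* 1) / suc D + recip (suc a)    ≡⟨ /-+ (1 Nat.* 1) D 1 (suc a) ⟩
  ℤ.+ numerator / suc D'                     ≤⟨ /-≤ numerator D' 1 a cross ⟩
  recip a                                    ∎
  where
  open ℚₚ.≤-Reasoning
  D : ℕ
  D = suc a Nat.+ suc a Nat.* suc (suc a)
  D' : ℕ
  D' = suc a Nat.+ D Nat.* suc (suc a)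
  numerator : ℕ
  numerator = 1 Nat.* 1 Nat.* suc (suc a) Nat.+ 1 Nat.* suc D
  identity : ∀ a → (1 Nat.* 1 Nat.* suc (suc a) Nat.+ 1 Nat.* suc (suc a Nat.+ suc a Nat.* suc (suc a))) Nat.* suc a Nat.+ suc (suc a)
                   ≡ 1 Nat.* suc (suc a Nat.+ (suc a Nat.+ suc a Nat.* suc (suc a)) Nat.* suc (suc a))
  identity = ℕ-Solver.solve-∀
  cross : numerator Nat.* suc a ≤ₙ 1 Nat.* suc D'
  cross = subst (numerator Nat.* suc a ≤ₙ_) (identity a) (ℕₚ.m≤m+n _ _)

recip²-tail : ∀ a len → sumℕ len (λ j → recip² (suc a Nat.+ j)) + recip (a Nat.+ len) ≤ recip a
recip²-tail a zero = ℚₚ.≤-reflexive (trans (ℚₚ.+-identityˡ _) (cong recip (ℕₚ.+-identityʳ a)))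
recip²-tail a (suc len) = begin
  recip² (suc a Nat.+ 0) + sumℕ len (λ j → recip² (suc a Nat.+ suc j)) + recip (a Nat.+ suc len)
    ≡⟨ cong₂ (λ x y → recip² x + y + recip (a Nat.+ suc len)) (ℕₚ.+-identityʳ (suc a))
             (sumℕ-cong len (λ k _ → cong recip² (ℕₚ.+-suc (suc a) k))) ⟩
  recip² (suc a) + rest + recip (a Nat.+ suc len)
    ≡⟨ ℚₚ.+-assoc (recip² (suc a)) rest _ ⟩
  recip² (suc a) + (rest + recip (a Nat.+ suc len))
    ≡⟨ cong (λ x → recip² (suc a) + (rest + recip x)) (ℕₚ.+-suc a len) ⟩
  recip² (suc a) + (rest + recip (suc a Nat.+ len))
    ≤⟨ ℚₚ.+-monoʳ-≤ (recip² (suc a)) (recip²-tail (suc a) len) ⟩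
  recip² (suc a) + recip (suc a)
    ≤⟨ recip²-step a ⟩
  recip a
    ∎
  where
  open ℚₚ.≤-Reasoning
  rest : ℚ
  rest = sumℕ len (λ j → recip² (suc (suc a) Nat.+ j))

precedes : ∀ {m} → Fin m → Fin m → ℚ
precedes k j = iverson (toℕ k <ᵇ toℕ j)

-- For a subset D of Fin m with indicator d and weights φ, the Bonferroni-type
-- sum Σ_{j∈D} φ j · (1 − #{k ∈ D : k < j}) gives weight 1 to the first
-- element of D and weight ≤ 0 to every later one.
leadingSum : ∀ m → (Fin m → Bool) → (Fin m → ℚ) → ℚ
leadingSum m d φ = sumFin m (λ j → iverson (d j) * φ j * (1ℚ - sumFin m (λ k → precedes k j * iverson (d k))))

-- Hence for φ ≥ 0 it is at most any bound P ≥ 0 on φ over D: this is how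
-- max_{j∈D} φ j is bounded below by a quantity linear in the indicators.
leadingSum-≤ : ∀ m (d : Fin m → Bool) (φ : Fin m → ℚ) (P : ℚ) → (∀ j → 0ℚ ≤ φ j) → 0ℚ ≤ P →
  (∀ j → d j ≡ true → φ j ≤ P) → leadingSum m d φ ≤ P
leadingSum-≤ zero    d φ P _   0≤P _   = 0≤P
leadingSum-≤ (suc m) d φ P 0≤φ 0≤P φ≤P with d zero in d₀
... | false = ℚₚ.≤-trans (ℚₚ.≤-reflexive (trans (cong₂ _+_ (vanish (φ zero) _) later)
                                                     (ℚₚ.+-identityˡ (leadingSum m (λ j → d (suc j)) (λ j → φ (suc j))))))
                         (leadingSum-≤ m (λ j → d (suc j)) (λ j → φ (suc j)) P (λ j → 0≤φ (suc j)) 0≤P (λ j → φ≤P (suc j)))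
  where
  vanish : ∀ (a x : ℚ) → 0ℚ * a * x ≡ 0ℚ
  vanish = solve-∀ ℚ-ring
  -- the absent first element does not count as a predecessor
  later : sumFin m (λ j → iverson (d (suc j)) * φ (suc j) * (1ℚ - (0ℚ + sumFin m (λ k → precedes k j * iverson (d (suc k))))))
        ≡ leadingSum m (λ j → d (suc j)) (λ j → φ (suc j))
  later = sumFin-cong m (λ j → cong (λ x → iverson (d (suc j)) * φ (suc j) * (1ℚ - x))
                               (ℚₚ.+-identityˡ (sumFin m (λ k → precedes k j * iverson (d (suc k))))))
... | true = ℚₚ.≤-trans (ℚₚ.+-mono-≤ (ℚₚ.≤-reflexive first) (sumFin-nonpos m later))
                        (ℚₚ.≤-trans (ℚₚ.≤-reflexive (ℚₚ.+-identityʳ (φ zero))) (φ≤P zero d₀))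
  where
  -- the first element of D has no predecessor in D …
  first : 1ℚ * φ zero * (1ℚ - (0ℚ + sumFin m (λ k → 0ℚ * iverson (d (suc k))))) ≡ φ zero
  first = trans (cong (λ x → 1ℚ * φ zero * (1ℚ - (0ℚ + x)))
                  (trans (sumFin-cong m (λ k → ℚₚ.*-zeroˡ (iverson (d (suc k))))) (sumFin-0 m)))
                (simplify (φ zero))
    where
    simplify : ∀ (x : ℚ) → 1ℚ * x * (1ℚ - (0ℚ + 0ℚ)) ≡ x
    simplify = solve-∀ ℚ-ring
  -- … and every later element of D has it as a predecessor
  later : ∀ j → iverson (d (suc j)) * φ (suc j) * (1ℚ - (1ℚ + sumFin m (λ k → precedes k j * iverson (d (suc k))))) ≤ 0ℚ
  later j = ℚₚ.≤-trans (ℚₚ.≤-reflexive (negate (iverson (d (suc j)) * φ (suc j)) (sumFin m (λ k → precedes k j * iverson (d (suc k))))))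
    (ℚₚ.neg-antimono-≤ (*-nonneg (*-nonneg (iverson-nonneg (d (suc j))) (0≤φ (suc j)))
      (sumFin-nonneg m (λ k → *-nonneg (iverson-nonneg (toℕ k <ᵇ toℕ j)) (iverson-nonneg (d (suc k)))))))
    where
    negate : ∀ (x A : ℚ) → x * (1ℚ - (1ℚ + A)) ≡ - (x * A)
    negate = solve-∀ ℚ-ring

-- All sums over hash functions h and sign functions s
-- below are unnormalised expectations (scaled by Bⁿ and 2ⁿ respectively).
module CountSketch (n b : ℕ) (i : Fin n) where

  B : ℕ
  B = suc b

  r : ℚ
  r = recip b

  signCount hashCount : ℚ
  signCount = fromℕ (2 Nat.^ n)
  hashCount = fromℕ (B Nat.^ n)

  r-nonneg : 0ℚ ≤ r
  r-nonneg = recip-nonneg b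

  err : (Fin n → Fin B) → (Fin n → Fin 2) → ℚ
  err h s = estimate n B h s i - sgn (s i) * freq i

  contribution : (Fin n → Fin B) → (Fin n → Fin 2) → Fin n → ℚ
  contribution h s j = ind (h j) (h i) * (sgn (s j) * freq j)

  inHead inTail : Fin n → Bool
  inHead j = (toℕ j <ᵇ B) ∧ not (does (j ≟ i))
  inTail j = not (toℕ j <ᵇ B) ∧ not (does (j ≟ i))

  partition : ∀ j → ind j i + iverson (inHead j) + iverson (inTail j) ≡ 1ℚ
  partition j with toℕ j <ᵇ B | does (j ≟ i)
  ... | true  | true  = refl
  ... | true  | false = refl
  ... | false | true  = refl
  ... | false | false = refl

  inHead-i : inHead i ≡ false
  inHead-i with i ≟ i | toℕ i <ᵇ B
  ... | yes _ | true  = refl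
  ... | yes _ | false = refl
  ... | no i≢i | _    = ⊥-elim (i≢i refl)

  inTail-i : inTail i ≡ false
  inTail-i with i ≟ i | toℕ i <ᵇ B
  ... | yes _ | true  = refl
  ... | yes _ | false = refl
  ... | no i≢i | _    = ⊥-elim (i≢i refl)

  headError tailError : (Fin n → Fin B) → (Fin n → Fin 2) → ℚ
  headError h s = sumFin n (λ j → iverson (inHead j) * contribution h s j)
  tailError h s = sumFin n (λ j → iverson (inTail j) * contribution h s j)

  -- Item i contributes exactly s(i) f_i, so the error is the head part plus
  -- the tail part.
  err-split : ∀ h s → err h s ≡ headError h s + tailError h s
  err-split h s = begin
    estimate n B h s i - own
      ≡⟨ cong (_- own) (sumFin-cong n split-term) ⟩
    sumFin n (λ j → ind j i * c j + iverson (inHead j) * c j + iverson (inTail j) * c j) - own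
      ≡⟨ cong (_- own) (trans (sumFin-+ n _ (λ j → iverson (inTail j) * c j))
                              (cong (_+ tailError h s) (sumFin-+ n (λ j → ind j i * c j) _))) ⟩
    sumFin n (λ j → ind j i * c j) + headError h s + tailError h s - own
      ≡⟨ cong (λ x → x + headError h s + tailError h s - own) sift ⟩
    own + headError h s + tailError h s - own
      ≡⟨ cancel own (headError h s) (tailError h s) ⟩
    headError h s + tailError h s
      ∎
    where
    open ≡-Reasoning
    c : Fin n → ℚ
    c = contribution h s
    own : ℚ
    own = sgn (s i) * freq i
    distribute : ∀ (a b' c' x : ℚ) → (a + b' + c') * x ≡ a * x + b' * x + c' * x
    distribute = solve-∀ ℚ-ring
    split-term : ∀ j → c j ≡ ind j i * c j + iverson (inHead j) * c j + iverson (inTail j) * c j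
    split-term j = trans (sym (ℚₚ.*-identityˡ (c j)))
                         (trans (cong (_* c j) (sym (partition j))) (distribute (ind j i) (iverson (inHead j)) (iverson (inTail j)) (c j)))
    sift : sumFin n (λ j → ind j i * c j) ≡ own
    sift = trans (sumFin-sift n i c) (trans (cong (_* own) (ind-refl (h i))) (ℚₚ.*-identityˡ own))
    cancel : ∀ (a x y : ℚ) → a + x + y - a ≡ x + y
    cancel = solve-∀ ℚ-ring

  -- The head error is bounded pointwise by the head mass
  -- colliding with i; the tail error by AM–GM through its second moment,
  -- which the orthogonality of the signs reduces to the tail mass of squares.
  headMass tailMass : (Fin n → Fin B) → ℚ
  headMass h = sumFin n (λ j → iverson (inHead j) * (ind (h j) (h i) * freq j))
  tailMass h = sumFin n (λ j → iverson (inTail j) * (ind (h j) (h i) * (freq j * freq j)))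

  headError-abs : ∀ h s → ∣ headError h s ∣ ≤ headMass h
  headError-abs h s = ℚₚ.≤-trans (sumFin-abs n _) (ℚₚ.≤-reflexive (sumFin-cong n term))
    where
    term : ∀ j → ∣ iverson (inHead j) * contribution h s j ∣ ≡ iverson (inHead j) * (ind (h j) (h i) * freq j)
    term j = begin
      ∣ iverson (inHead j) * (ind (h j) (h i) * (sgn (s j) * freq j)) ∣
        ≡⟨ ℚₚ.∣p*q∣≡∣p∣*∣q∣ (iverson (inHead j)) _ ⟩
      ∣ iverson (inHead j) ∣ * ∣ ind (h j) (h i) * (sgn (s j) * freq j) ∣
        ≡⟨ cong₂ _*_ (iverson-abs (inHead j)) (ℚₚ.∣p*q∣≡∣p∣*∣q∣ (ind (h j) (h i)) _) ⟩
      iverson (inHead j) * (∣ ind (h j) (h i) ∣ * ∣ sgn (s j) * freq j ∣)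
        ≡⟨ cong (λ x → iverson (inHead j) * (x * ∣ sgn (s j) * freq j ∣)) (iverson-abs (does (h j ≟ h i))) ⟩
      iverson (inHead j) * (ind (h j) (h i) * ∣ sgn (s j) * freq j ∣)
        ≡⟨ cong (λ x → iverson (inHead j) * (ind (h j) (h i) * x)) (ℚₚ.∣p*q∣≡∣p∣*∣q∣ (sgn (s j)) (freq j)) ⟩
      iverson (inHead j) * (ind (h j) (h i) * (∣ sgn (s j) ∣ * ∣ freq j ∣))
        ≡⟨ cong₂ (λ x y → iverson (inHead j) * (ind (h j) (h i) * (x * y))) (sgn-abs (s j)) (ℚₚ.0≤p⇒∣p∣≡p (recip-nonneg (toℕ j))) ⟩
      iverson (inHead j) * (ind (h j) (h i) * (1ℚ * freq j))
        ≡⟨ cong (λ x → iverson (inHead j) * (ind (h j) (h i) * x)) (ℚₚ.*-identityˡ (freq j)) ⟩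
      iverson (inHead j) * (ind (h j) (h i) * freq j)
        ∎
      where open ≡-Reasoning

  tailError-second-moment : ∀ h → sumFuns n 2 (λ s → tailError h s * tailError h s) ≡ signCount * tailMass h
  tailError-second-moment h = begin
    sumFuns n 2 (λ s → tailError h s * tailError h s)
      ≡⟨ sumFuns-cong n 2 (λ s → trans (sumFin-product n n _ _) (sumFin-cong n (λ j → sumFin-cong n (λ k → factor s j k)))) ⟩
    sumFuns n 2 (λ s → sumFin n (λ j → sumFin n (λ k → a j * a k * (sgn (s j) * sgn (s k)))))
      ≡⟨ sumFuns-sumFin n 2 n _ ⟩
    sumFin n (λ j → sumFuns n 2 (λ s → sumFin n (λ k → a j * a k * (sgn (s j) * sgn (s k)))))
      ≡⟨ sumFin-cong n (λ j → trans (sumFuns-sumFin n 2 n _) (sumFin-cong n (λ k → average j k))) ⟩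
    sumFin n (λ j → sumFin n (λ k → ind k j * (signCount * (a j * a k))))
      ≡⟨ sumFin-cong n (λ j → sumFin-sift n j (λ k → signCount * (a j * a k))) ⟩
    sumFin n (λ j → signCount * (a j * a j))
      ≡⟨ sumFin-* n signCount _ ⟩
    signCount * sumFin n (λ j → a j * a j)
      ≡⟨ cong (signCount *_) (sumFin-cong n diagonal) ⟩
    signCount * tailMass h
      ∎
    where
    open ≡-Reasoning
    a : Fin n → ℚ
    a j = iverson (inTail j) * ind (h j) (h i) * freq j
    regroup : ∀ (w c g f w' c' g' f' : ℚ) → (w * (c * (g * f))) * (w' * (c' * (g' * f'))) ≡ (w * c * f) * (w' * c' * f') * (g * g')
    regroup = solve-∀ ℚ-ring
    factor : ∀ s j k → iverson (inTail j) * contribution h s j * (iverson (inTail k) * contribution h s k)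
                       ≡ a j * a k * (sgn (s j) * sgn (s k))
    factor s j k = regroup (iverson (inTail j)) (ind (h j) (h i)) (sgn (s j)) (freq j)
                           (iverson (inTail k)) (ind (h k) (h i)) (sgn (s k)) (freq k)
    rotate : ∀ (x q d : ℚ) → x * (q * d) ≡ d * (q * x)
    rotate = solve-∀ ℚ-ring
    average : ∀ j k → sumFuns n 2 (λ s → a j * a k * (sgn (s j) * sgn (s k))) ≡ ind k j * (signCount * (a j * a k))
    average j k = trans (sumFuns-* n 2 (a j * a k) _)
                        (trans (cong (a j * a k *_) (sign-correlation n j k)) (rotate (a j * a k) signCount (ind k j)))
    square : ∀ (w c f : ℚ) → (w * c * f) * (w * c * f) ≡ (w * w) * ((c * c) * (f * f))
    square = solve-∀ ℚ-ring
    diagonal : ∀ j → a j * a j ≡ iverson (inTail j) * (ind (h j) (h i) * (freq j * freq j))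
    diagonal j = trans (square (iverson (inTail j)) (ind (h j) (h i)) (freq j))
      (cong₂ (λ x y → x * (y * (freq j * freq j))) (iverson-idem (inTail j)) (iverson-idem (does (h j ≟ h i))))

  err-upper-fixed-hash : ∀ h → sumFuns n 2 (λ s → ∣ err h s ∣)
                              ≤ signCount * headMass h + (fromℕ B * (signCount * tailMass h) + signCount * r) * ½
  err-upper-fixed-hash h = begin
    sumFuns n 2 (λ s → ∣ err h s ∣)
      ≤⟨ sumFuns-mono n 2 pointwise ⟩
    sumFuns n 2 (λ s → headMass h + (fromℕ B * (tailError h s * tailError h s) + r) * ½)
      ≡⟨ sumFuns-cong n 2 (λ s → separate (headMass h) (fromℕ B) (tailError h s * tailError h s) r ½) ⟩
    sumFuns n 2 (λ s → (headMass h + r * ½) + (fromℕ B * ½) * (tailError h s * tailError h s))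
      ≡⟨ sumFuns-+ n 2 (λ _ → headMass h + r * ½) _ ⟩
    sumFuns n 2 (λ _ → headMass h + r * ½) + sumFuns n 2 (λ s → (fromℕ B * ½) * (tailError h s * tailError h s))
      ≡⟨ cong₂ _+_ (sumFuns-const n 2 _)
                   (trans (sumFuns-* n 2 (fromℕ B * ½) _) (cong (fromℕ B * ½ *_) (tailError-second-moment h))) ⟩
    signCount * (headMass h + r * ½) + (fromℕ B * ½) * (signCount * tailMass h)
      ≡⟨ collect signCount (headMass h) r ½ (fromℕ B) (tailMass h) ⟩
    signCount * headMass h + (fromℕ B * (signCount * tailMass h) + signCount * r) * ½
      ∎
    where
    open ℚₚ.≤-Reasoning
    pointwise : ∀ s → ∣ err h s ∣ ≤ headMass h + (fromℕ B * (tailError h s * tailError h s) + r) * ½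
    pointwise s = begin
      ∣ err h s ∣                                  ≡⟨ cong ∣_∣ (err-split h s) ⟩
      ∣ headError h s + tailError h s ∣            ≤⟨ ℚₚ.∣p+q∣≤∣p∣+∣q∣ (headError h s) (tailError h s) ⟩
      ∣ headError h s ∣ + ∣ tailError h s ∣        ≤⟨ ℚₚ.+-mono-≤ (headError-abs h s)
                                                        (am-gm (fromℕ B) r (tailError h s) (recip-inverse b) r-nonneg) ⟩
      headMass h + (fromℕ B * (tailError h s * tailError h s) + r) * ½   ∎
    separate : ∀ (L q y r' t : ℚ) → L + (q * y + r') * t ≡ (L + r' * t) + (q * t) * y
    separate = solve-∀ ℚ-ring
    collect : ∀ (P L r' t q A : ℚ) → P * (L + r' * t) + (q * t) * (P * A) ≡ P * L + (q * (P * A) + P * r') * t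
    collect = solve-∀ ℚ-ring

  hash-average : ∀ (w c : Fin n → ℚ) → w i ≡ 0ℚ →
    sumFuns n B (λ h → sumFin n (λ j → w j * (ind (h j) (h i) * c j))) ≡ hashCount * (r * sumFin n (λ j → w j * c j))
  hash-average w c wᵢ≡0 = begin
    sumFuns n B (λ h → sumFin n (λ j → w j * (ind (h j) (h i) * c j)))
      ≡⟨ sumFuns-sumFin n B n _ ⟩
    sumFin n (λ j → sumFuns n B (λ h → w j * (ind (h j) (h i) * c j)))
      ≡⟨ sumFin-cong n per-item ⟩
    sumFin n (λ j → hashCount * r * (w j * c j))
      ≡⟨ sumFin-* n (hashCount * r) _ ⟩
    hashCount * r * sumFin n (λ j → w j * c j)
      ≡⟨ ℚₚ.*-assoc hashCount r _ ⟩
    hashCount * (r * sumFin n (λ j → w j * c j))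
      ∎
    where
    open ≡-Reasoning
    regroup : ∀ (x d y : ℚ) → x * (d * y) ≡ (x * y) * d
    regroup = solve-∀ ℚ-ring
    collisions : ∀ j → Dec (j ≡ i) → (w j * c j) * sumFuns n B (λ h → ind (h j) (h i)) ≡ hashCount * r * (w j * c j)
    collisions j (yes refl) = trans (cong (_* S) vanish) (trans (ℚₚ.*-zeroˡ S)
                                    (sym (trans (cong (hashCount * r *_) vanish) (ℚₚ.*-zeroʳ (hashCount * r)))))
      where
      S : ℚ
      S = sumFuns n B (λ h → ind (h j) (h j))
      vanish : w j * c j ≡ 0ℚ
      vanish = trans (cong (_* c j) wᵢ≡0) (ℚₚ.*-zeroˡ (c j))
    collisions j (no j≢i) = trans (cong (w j * c j *_) (pair-collisions b n j i j≢i)) (ℚₚ.*-comm (w j * c j) _)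
    per-item : ∀ j → sumFuns n B (λ h → w j * (ind (h j) (h i) * c j)) ≡ hashCount * r * (w j * c j)
    per-item j = trans (sumFuns-cong n B (λ h → regroup (w j) (ind (h j) (h i)) (c j)))
                       (trans (sumFuns-* n B (w j * c j) _) (collisions j (j ≟ i)))

  headWeight tailWeight : ℚ
  headWeight = sumFin n (λ j → iverson (inHead j) * freq j)
  tailWeight = sumFin n (λ j → iverson (inTail j) * (freq j * freq j))

  totalError : ℚ
  totalError = sumFuns n B (λ h → sumFuns n 2 (λ s → ∣ err h s ∣))

  totalError-upper : totalError ≤ signCount * hashCount * (r * headWeight + (tailWeight + r) * ½)
  totalError-upper = begin
    totalError
      ≤⟨ sumFuns-mono n B err-upper-fixed-hash ⟩
    sumFuns n B (λ h → signCount * headMass h + (fromℕ B * (signCount * tailMass h) + signCount * r) * ½)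
      ≡⟨ sumFuns-cong n B (λ h → separate signCount (headMass h) (fromℕ B) (tailMass h) r ½) ⟩
    sumFuns n B (λ h → signCount * r * ½ + (signCount * headMass h + (fromℕ B * signCount * ½) * tailMass h))
      ≡⟨ sumFuns-+ n B (λ _ → signCount * r * ½) _ ⟩
    sumFuns n B (λ _ → signCount * r * ½)
      + sumFuns n B (λ h → signCount * headMass h + (fromℕ B * signCount * ½) * tailMass h)
      ≡⟨ cong₂ _+_ (sumFuns-const n B _) (sumFuns-+ n B (λ h → signCount * headMass h) _) ⟩
    hashCount * (signCount * r * ½)
      + (sumFuns n B (λ h → signCount * headMass h) + sumFuns n B (λ h → (fromℕ B * signCount * ½) * tailMass h))
      ≡⟨ cong (hashCount * (signCount * r * ½) +_) (cong₂ _+_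
           (trans (sumFuns-* n B signCount headMass) (cong (signCount *_) (hash-average (λ j → iverson (inHead j)) freq (cong iverson inHead-i))))
           (trans (sumFuns-* n B (fromℕ B * signCount * ½) tailMass) (cong (fromℕ B * signCount * ½ *_)
             (hash-average (λ j → iverson (inTail j)) (λ j → freq j * freq j) (cong iverson inTail-i))))) ⟩
    hashCount * (signCount * r * ½)
      + (signCount * (hashCount * (r * headWeight)) + (fromℕ B * signCount * ½) * (hashCount * (r * tailWeight)))
      ≡⟨ collect signCount hashCount r headWeight (fromℕ B) tailWeight ½ ⟩
    signCount * hashCount * (r * headWeight + (tailWeight * (fromℕ B * r) + r) * ½)
      ≡⟨ cong (λ x → signCount * hashCount * (r * headWeight + (tailWeight * x + r) * ½)) (recip-inverse b) ⟩
    signCount * hashCount * (r * headWeight + (tailWeight * 1ℚ + r) * ½)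
      ≡⟨ cong (λ x → signCount * hashCount * (r * headWeight + (x + r) * ½)) (ℚₚ.*-identityʳ tailWeight) ⟩
    signCount * hashCount * (r * headWeight + (tailWeight + r) * ½)
      ∎
    where
    open ℚₚ.≤-Reasoning
    separate : ∀ (P L q A r' t : ℚ) → P * L + (q * (P * A) + P * r') * t ≡ P * r' * t + (P * L + (q * P * t) * A)
    separate = solve-∀ ℚ-ring
    collect : ∀ (P H r' W₁ q W₂ t : ℚ) → H * (P * r' * t) + (P * (H * (r' * W₁)) + (q * P * t) * (H * (r' * W₂)))
                                         ≡ P * H * (r' * W₁ + (W₂ * (q * r') + r') * t)
    collect = solve-∀ ℚ-ring

  -- Flipping the sign of an item j ≠ i changes the error by
  -- exactly 2 [h j = h i] f_j, so averaged over the signs the absolute error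
  -- is at least [h j = h i] f_j, for every such j simultaneously.
  err-flip : ∀ h s j → ¬ j ≡ i →
    err h s - err h (flipSignAt j s) ≡ ind (h j) (h i) * ((sgn (s j) - sgn (flipSign (s j))) * freq j)
  err-flip h s j j≢i = begin
    estimate n B h s i - sgn (s i) * freq i - (estimate n B h s' i - sgn (s' i) * freq i)
      ≡⟨ cong (λ t → estimate n B h s i - sgn (s i) * freq i - (estimate n B h s' i - sgn t * freq i))
              (flipSignAt-elsewhere j i s j≢i) ⟩
    estimate n B h s i - sgn (s i) * freq i - (estimate n B h s' i - sgn (s i) * freq i)
      ≡⟨ cancel (estimate n B h s i) (estimate n B h s' i) (sgn (s i) * freq i) ⟩
    estimate n B h s i - estimate n B h s' i
      ≡⟨ sumFin-- n (contribution h s) (contribution h s') ⟨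
    sumFin n (λ k → contribution h s k - contribution h s' k)
      ≡⟨ sumFin-cong n only-j ⟩
    sumFin n (λ k → ind k j * (contribution h s j - contribution h s' j))
      ≡⟨ sumFin-sift n j (λ _ → contribution h s j - contribution h s' j) ⟩
    contribution h s j - ind (h j) (h i) * (sgn (s' j) * freq j)
      ≡⟨ cong (λ t → contribution h s j - ind (h j) (h i) * (sgn t * freq j)) (flipSignAt-here j s) ⟩
    contribution h s j - ind (h j) (h i) * (sgn (flipSign (s j)) * freq j)
      ≡⟨ factor (ind (h j) (h i)) (sgn (s j)) (sgn (flipSign (s j))) (freq j) ⟩
    ind (h j) (h i) * ((sgn (s j) - sgn (flipSign (s j))) * freq j)
      ∎
    where
    open ≡-Reasoning
    s' : Fin n → Fin 2
    s' = flipSignAt j s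
    cancel : ∀ (E E' a : ℚ) → E - a - (E' - a) ≡ E - E'
    cancel = solve-∀ ℚ-ring
    factor : ∀ (c g g' f : ℚ) → c * (g * f) - c * (g' * f) ≡ c * ((g - g') * f)
    factor = solve-∀ ℚ-ring
    only-j : ∀ k → contribution h s k - contribution h s' k ≡ ind k j * (contribution h s j - contribution h s' j)
    only-j k = by-cases (k ≟ j)
      where
      by-cases : Dec (k ≡ j) → contribution h s k - contribution h s' k
                               ≡ ind k j * (contribution h s j - contribution h s' j)
      by-cases (yes refl) = sym (trans (cong (_* (contribution h s k - contribution h s' k)) (ind-refl k))
                                       (ℚₚ.*-identityˡ (contribution h s k - contribution h s' k)))
      by-cases (no k≢j) = trans (cong (λ t → contribution h s k - ind (h k) (h i) * (sgn t * freq k))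
                                      (flipSignAt-elsewhere j k s (λ e → k≢j (sym e))))
                                (trans (ℚₚ.+-inverseʳ (contribution h s k))
                                       (sym (trans (cong (_* (contribution h s j - contribution h s' j)) (ind-≢ k≢j))
                                                   (ℚₚ.*-zeroˡ (contribution h s j - contribution h s' j)))))

  signAverage : (Fin n → Fin B) → ℚ
  signAverage h = sumFuns n 2 (λ s → ∣ err h s ∣)

  signAverage-nonneg : ∀ h → 0ℚ ≤ signAverage h
  signAverage-nonneg h = sumFuns-nonneg n 2 (λ s → ℚₚ.0≤∣p∣ (err h s))

  signAverage-single : ∀ h j → ¬ j ≡ i → signCount * (ind (h j) (h i) * freq j) ≤ signAverage h
  signAverage-single h j j≢i = begin
    signCount * (c * freq j)                       ≡⟨ halve signCount c (freq j) ⟨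
    signCount * (c * (fromℕ 2 * freq j)) * ½       ≤⟨ *-monoʳ-≤ (ℚₚ.nonNegative⁻¹ ½) paired ⟩
    (signAverage h + signAverage h) * ½            ≡⟨ halve-sum (signAverage h) ⟩
    signAverage h                                  ∎
    where
    open ℚₚ.≤-Reasoning
    c : ℚ
    c = ind (h j) (h i)
    halve : ∀ (P c f : ℚ) → P * (c * (fromℕ 2 * f)) * ½ ≡ P * (c * f)
    halve = solve-∀ ℚ-ring
    halve-sum : ∀ (S : ℚ) → (S + S) * ½ ≡ S
    halve-sum = solve-∀ ℚ-ring
    flip-gap : ∀ s → c * (fromℕ 2 * freq j) ≤ ∣ err h s ∣ + ∣ err h (flipSignAt j s) ∣
    flip-gap s = ℚₚ.≤-trans (ℚₚ.≤-reflexive (sym (begin-equality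
      ∣ err h s - err h (flipSignAt j s) ∣                              ≡⟨ cong ∣_∣ (err-flip h s j j≢i) ⟩
      ∣ c * ((sgn (s j) - sgn (flipSign (s j))) * freq j) ∣             ≡⟨ ℚₚ.∣p*q∣≡∣p∣*∣q∣ c _ ⟩
      ∣ c ∣ * ∣ (sgn (s j) - sgn (flipSign (s j))) * freq j ∣           ≡⟨ cong₂ _*_ (iverson-abs (does (h j ≟ h i)))
                                                                                (ℚₚ.∣p*q∣≡∣p∣*∣q∣ (sgn (s j) - sgn (flipSign (s j))) (freq j)) ⟩
      c * (∣ sgn (s j) - sgn (flipSign (s j)) ∣ * ∣ freq j ∣)           ≡⟨ cong₂ (λ x y → c * (x * y)) (sgn-flip (s j))
                                                                                (ℚₚ.0≤p⇒∣p∣≡p (recip-nonneg (toℕ j))) ⟩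
      c * (fromℕ 2 * freq j)                                            ∎)))
      (ℚₚ.∣p-q∣≤∣p∣+∣q∣ (err h s) (err h (flipSignAt j s)))
    paired : signCount * (c * (fromℕ 2 * freq j)) ≤ signAverage h + signAverage h
    paired = begin
      signCount * (c * (fromℕ 2 * freq j))
        ≡⟨ sumFuns-const n 2 _ ⟨
      sumFuns n 2 (λ _ → c * (fromℕ 2 * freq j))
        ≤⟨ sumFuns-mono n 2 flip-gap ⟩
      sumFuns n 2 (λ s → ∣ err h s ∣ + ∣ err h (flipSignAt j s) ∣)
        ≡⟨ sumFuns-+ n 2 (λ s → ∣ err h s ∣) (λ s → ∣ err h (flipSignAt j s) ∣) ⟩
      signAverage h + sumFuns n 2 (λ s → ∣ err h (flipSignAt j s) ∣)
        ≡⟨ cong (signAverage h +_) (sumFuns-flipSignAt n j (λ s → ∣ err h s ∣)) ⟩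
      signAverage h + signAverage h
        ∎

  -- For a fixed h, the head items colliding with i form a set on which the
  -- weights 2ⁿ f_j are all at most signAverage h, so leadingSum-≤ applies.
  collided : (Fin n → Fin B) → Fin n → Bool
  collided h j = inHead j ∧ does (h j ≟ h i)

  weight : Fin n → ℚ
  weight j = signCount * freq j

  signAverage-leading : ∀ h → leadingSum n (collided h) weight ≤ signAverage h
  signAverage-leading h = leadingSum-≤ n (collided h) weight (signAverage h)
    (λ j → *-nonneg (fromℕ-nonneg (2 Nat.^ n)) (recip-nonneg (toℕ j))) (signAverage-nonneg h) bounded
    where
    both : ∀ {x y} → x ∧ y ≡ true → (x ≡ true) × (y ≡ true)
    both {true} {true} _ = refl , refl
    bounded : ∀ j → collided h j ≡ true → weight j ≤ signAverage h
    bounded j collided≡true with both {inHead j} collided≡true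
    ... | head≡true , hit≡true = ℚₚ.≤-trans
      (ℚₚ.≤-reflexive (cong (signCount *_) (sym (trans (cong (λ t → iverson t * freq j) hit≡true) (ℚₚ.*-identityˡ (freq j))))))
      (signAverage-single h j (λ { refl → true≢false (trans (sym head≡true) inHead-i) }))
      where
      true≢false : true ≡ false → ⊥
      true≢false ()

  -- Expanding the indicators of `collided h` turns leadingSum into a
  -- polynomial in the collision indicators [h j = h i] of degree two.
  precedence : Fin n → Fin n → ℚ
  precedence j k = iverson (inHead j) * weight j * precedes k j * iverson (inHead k)

  leadingSum-expand : ∀ h → leadingSum n (collided h) weight
    ≡ sumFin n (λ j → iverson (inHead j) * (ind (h j) (h i) * weight j))
      - sumFin n (λ j → sumFin n (λ k → precedence j k * (ind (h j) (h i) * ind (h k) (h i))))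
  leadingSum-expand h = trans (sumFin-cong n per-item) (sumFin-- n _ _)
    where
    c : Fin n → ℚ
    c j = ind (h j) (h i)
    distribute : ∀ (D p A : ℚ) → D * p * (1ℚ - A) ≡ D * p - D * p * A
    distribute = solve-∀ ℚ-ring
    reassociate : ∀ (w x p : ℚ) → w * x * p ≡ w * (x * p)
    reassociate = solve-∀ ℚ-ring
    regroup : ∀ (w x p q w' x' : ℚ) → w * x * p * (q * (w' * x')) ≡ w * p * q * w' * (x * x')
    regroup = solve-∀ ℚ-ring
    per-item : ∀ j → iverson (collided h j) * weight j * (1ℚ - sumFin n (λ k → precedes k j * iverson (collided h k)))
                     ≡ iverson (inHead j) * (c j * weight j) - sumFin n (λ k → precedence j k * (c j * c k))
    per-item j = begin
      iverson (collided h j) * weight j * (1ℚ - sumFin n (λ k → precedes k j * iverson (collided h k)))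
        ≡⟨ cong (λ x → x * weight j * (1ℚ - sumFin n (λ k → precedes k j * iverson (collided h k)))) (iverson-∧ (inHead j) _) ⟩
      iverson (inHead j) * c j * weight j * (1ℚ - sumFin n (λ k → precedes k j * iverson (collided h k)))
        ≡⟨ distribute (iverson (inHead j) * c j) (weight j) _ ⟩
      iverson (inHead j) * c j * weight j - iverson (inHead j) * c j * weight j * sumFin n (λ k → precedes k j * iverson (collided h k))
        ≡⟨ cong₂ _-_ (reassociate (iverson (inHead j)) (c j) (weight j))
                     (sym (sumFin-* n (iverson (inHead j) * c j * weight j) _)) ⟩
      iverson (inHead j) * (c j * weight j) - sumFin n (λ k → iverson (inHead j) * c j * weight j * (precedes k j * iverson (collided h k)))
        ≡⟨ cong (λ x → iverson (inHead j) * (c j * weight j) - x) (sumFin-cong n (λ k →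
             trans (cong (λ x → iverson (inHead j) * c j * weight j * (precedes k j * x)) (iverson-∧ (inHead k) _))
                   (regroup (iverson (inHead j)) (c j) (weight j) (precedes k j) (iverson (inHead k)) (c k)))) ⟩
      iverson (inHead j) * (c j * weight j) - sumFin n (λ k → precedence j k * (c j * c k))
        ∎
      where open ≡-Reasoning

  -- Averaging the quadratic part: precedence vanishes unless j, k, i are
  -- distinct (i is not in the head, and no item precedes itself).
  pair-average-vanishing : ∀ j k → precedence j k ≡ 0ℚ →
    sumFuns n B (λ h → precedence j k * (ind (h j) (h i) * ind (h k) (h i))) ≡ precedence j k * (hashCount * (r * r))
  pair-average-vanishing j k p≡0 = trans (sumFuns-cong n B (λ h → trans (cong (_* (ind (h j) (h i) * ind (h k) (h i))) p≡0) (ℚₚ.*-zeroˡ (ind (h j) (h i) * ind (h k) (h i)))))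
                        (trans (sumFuns-0 n B) (sym (trans (cong (_* (hashCount * (r * r))) p≡0) (ℚₚ.*-zeroˡ (hashCount * (r * r))))))

  pair-average : ∀ j k →
    sumFuns n B (λ h → precedence j k * (ind (h j) (h i) * ind (h k) (h i))) ≡ precedence j k * (hashCount * (r * r))
  pair-average j k = by-cases (j ≟ i) (k ≟ i) (j ≟ k)
    where
    Goal : Set
    Goal = sumFuns n B (λ h → precedence j k * (ind (h j) (h i) * ind (h k) (h i))) ≡ precedence j k * (hashCount * (r * r))
    zero-first : ∀ (x y z : ℚ) → 0ℚ * x * y * z ≡ 0ℚ
    zero-first = solve-∀ ℚ-ring
    zero-third : ∀ (x y : ℚ) → x * 0ℚ * y ≡ 0ℚ
    zero-third = solve-∀ ℚ-ring
    by-cases : Dec (j ≡ i) → Dec (k ≡ i) → Dec (j ≡ k) → Goal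
    by-cases (yes refl) _ _ = pair-average-vanishing j k
      (trans (cong (λ t → iverson t * weight j * precedes k j * iverson (inHead k)) inHead-i)
             (zero-first (weight j) (precedes k j) (iverson (inHead k))))
    by-cases (no _) (yes refl) _ = pair-average-vanishing j k
      (trans (cong (λ t → iverson (inHead j) * weight j * precedes k j * iverson t) inHead-i)
             (ℚₚ.*-zeroʳ (iverson (inHead j) * weight j * precedes k j)))
    by-cases (no _) (no _) (yes refl) = pair-average-vanishing j k
      (trans (cong (λ t → iverson (inHead j) * weight j * iverson t * iverson (inHead j)) (<ᵇ-irrefl (toℕ j)))
             (zero-third (iverson (inHead j) * weight j) (iverson (inHead j))))
    by-cases (no j≢i) (no k≢i) (no j≢k) =
      trans (sumFuns-* n B (precedence j k) _) (cong (precedence j k *_) (triple-collisions b n j k i j≢k j≢i k≢i))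

  precedenceTotal : ℚ
  precedenceTotal = sumFin n (λ j → sumFin n (precedence j))

  leadingSum-average : sumFuns n B (λ h → leadingSum n (collided h) weight)
    ≡ hashCount * (r * sumFin n (λ j → iverson (inHead j) * weight j)) - hashCount * (r * r) * precedenceTotal
  leadingSum-average = trans (sumFuns-cong n B leadingSum-expand) (trans (sumFuns-- n B _ _)
    (cong₂ _-_ (hash-average (λ j → iverson (inHead j)) weight (cong iverson inHead-i)) quadratic))
    where
    quadratic : sumFuns n B (λ h → sumFin n (λ j → sumFin n (λ k → precedence j k * (ind (h j) (h i) * ind (h k) (h i)))))
                ≡ hashCount * (r * r) * precedenceTotal
    quadratic = trans (sumFuns-sumFin n B n _)
      (trans (sumFin-cong n (λ j → trans (sumFuns-sumFin n B n _)
               (trans (sumFin-cong n (λ k → trans (pair-average j k) (ℚₚ.*-comm (precedence j k) _)))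
                      (sumFin-* n (hashCount * (r * r)) (precedence j)))))
             (sumFin-* n (hashCount * (r * r)) _))

  -- A head item j has at most j predecessors and f_j · j ≤ 1, so the
  -- quadratic part is small: precedenceTotal ≤ 2ⁿ B.
  inHead-≤ : ∀ j → iverson (inHead j) ≤ iverson (toℕ j <ᵇ B)
  inHead-≤ j with toℕ j <ᵇ B
  ... | true  = iverson-≤1 (not (does (j ≟ i)))
  ... | false = ℚₚ.≤-refl

  precedenceTotal-≤ : precedenceTotal ≤ signCount * fromℕ B
  precedenceTotal-≤ = begin
    sumFin n (λ j → sumFin n (precedence j))          ≤⟨ sumFin-mono n per-item ⟩
    sumFin n (λ j → signCount * below j)              ≡⟨ sumFin-* n signCount below ⟩
    signCount * sumFin n below                        ≡⟨ cong (signCount *_) (sumFin-toℕ n (λ k → iverson (k <ᵇ B))) ⟩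
    signCount * sumℕ n (λ k → iverson (k <ᵇ B))       ≤⟨ *-monoˡ-≤ (fromℕ-nonneg (2 Nat.^ n)) (count-below n B) ⟩
    signCount * fromℕ B                               ∎
    where
    open ℚₚ.≤-Reasoning
    below : Fin n → ℚ
    below j = iverson (toℕ j <ᵇ B)
    regroup : ∀ (w p q w' : ℚ) → w * p * q * w' ≡ (w * p) * (q * w')
    regroup = solve-∀ ℚ-ring
    regroup' : ∀ (w P f t : ℚ) → w * (P * f) * t ≡ P * w * (f * t)
    regroup' = solve-∀ ℚ-ring
    predecessors : ∀ j → sumFin n (λ k → precedes k j * iverson (inHead k)) ≤ fromℕ (toℕ j)
    predecessors j = begin
      sumFin n (λ k → precedes k j * iverson (inHead k))
        ≤⟨ sumFin-mono n (λ k → ℚₚ.≤-trans (*-monoˡ-≤ (iverson-nonneg (toℕ k <ᵇ toℕ j)) (iverson-≤1 (inHead k)))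
                                           (ℚₚ.≤-reflexive (ℚₚ.*-identityʳ (precedes k j)))) ⟩
      sumFin n (λ k → precedes k j)
        ≡⟨ sumFin-toℕ n (λ k → iverson (k <ᵇ toℕ j)) ⟩
      sumℕ n (λ k → iverson (k <ᵇ toℕ j))
        ≤⟨ count-below n (toℕ j) ⟩
      fromℕ (toℕ j)
        ∎
    head-weight-nonneg : ∀ j → 0ℚ ≤ iverson (inHead j) * weight j
    head-weight-nonneg j = *-nonneg (iverson-nonneg (inHead j)) (*-nonneg (fromℕ-nonneg (2 Nat.^ n)) (recip-nonneg (toℕ j)))
    per-item : ∀ j → sumFin n (precedence j) ≤ signCount * below j
    per-item j = begin
      sumFin n (precedence j)
        ≡⟨ sumFin-cong n (λ k → regroup (iverson (inHead j)) (weight j) (precedes k j) (iverson (inHead k))) ⟩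
      sumFin n (λ k → iverson (inHead j) * weight j * (precedes k j * iverson (inHead k)))
        ≡⟨ sumFin-* n (iverson (inHead j) * weight j) _ ⟩
      iverson (inHead j) * weight j * sumFin n (λ k → precedes k j * iverson (inHead k))
        ≤⟨ *-monoˡ-≤ (head-weight-nonneg j) (predecessors j) ⟩
      iverson (inHead j) * weight j * fromℕ (toℕ j)
        ≡⟨ regroup' (iverson (inHead j)) signCount (freq j) (fromℕ (toℕ j)) ⟩
      signCount * iverson (inHead j) * (freq j * fromℕ (toℕ j))
        ≤⟨ *-monoˡ-≤ (*-nonneg (fromℕ-nonneg (2 Nat.^ n)) (iverson-nonneg (inHead j))) (recip-* (toℕ j)) ⟩
      signCount * iverson (inHead j) * 1ℚ
        ≡⟨ trans (ℚₚ.*-identityʳ _) (ℚₚ.*-comm signCount (iverson (inHead j))) ⟩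
      iverson (inHead j) * signCount
        ≤⟨ *-monoʳ-≤ (fromℕ-nonneg (2 Nat.^ n)) (inHead-≤ j) ⟩
      below j * signCount
        ≡⟨ ℚₚ.*-comm (below j) signCount ⟩
      signCount * below j
        ∎

  totalError-lower-leading : signCount * hashCount * (r * headWeight - r) ≤ totalError
  totalError-lower-leading = begin
    signCount * hashCount * (r * headWeight - r)
      ≡⟨ cong (λ x → signCount * hashCount * (r * headWeight - x)) (ℚₚ.*-identityʳ r) ⟨
    signCount * hashCount * (r * headWeight - r * 1ℚ)
      ≡⟨ cong (λ x → signCount * hashCount * (r * headWeight - r * x)) (recip-inverse b) ⟨
    signCount * hashCount * (r * headWeight - r * (fromℕ B * r))
      ≡⟨ expand signCount hashCount r headWeight (fromℕ B) ⟨
    hashCount * (r * (signCount * headWeight)) - hashCount * (r * r) * (signCount * fromℕ B)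
      ≤⟨ ℚₚ.+-monoʳ-≤ (hashCount * (r * (signCount * headWeight)))
           (ℚₚ.neg-antimono-≤ (*-monoˡ-≤ (*-nonneg (fromℕ-nonneg (B Nat.^ n)) (*-nonneg r-nonneg r-nonneg)) precedenceTotal-≤)) ⟩
    hashCount * (r * (signCount * headWeight)) - hashCount * (r * r) * precedenceTotal
      ≡⟨ cong (λ x → hashCount * (r * x) - hashCount * (r * r) * precedenceTotal) weighted ⟨
    hashCount * (r * sumFin n (λ j → iverson (inHead j) * weight j)) - hashCount * (r * r) * precedenceTotal
      ≡⟨ leadingSum-average ⟨
    sumFuns n B (λ h → leadingSum n (collided h) weight)
      ≤⟨ sumFuns-mono n B signAverage-leading ⟩
    totalError
      ∎
    where
    open ℚₚ.≤-Reasoning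
    expand : ∀ (P H r' W q : ℚ) → H * (r' * (P * W)) - H * (r' * r') * (P * q) ≡ P * H * (r' * W - r' * (q * r'))
    expand = solve-∀ ℚ-ring
    commute : ∀ (w P f : ℚ) → w * (P * f) ≡ P * (w * f)
    commute = solve-∀ ℚ-ring
    weighted : sumFin n (λ j → iverson (inHead j) * weight j) ≡ signCount * headWeight
    weighted = trans (sumFin-cong n (λ j → commute (iverson (inHead j)) signCount (freq j))) (sumFin-* n signCount _)

  totalError-lower-single : ∀ j → ¬ j ≡ i → signCount * hashCount * (r * freq j) ≤ totalError
  totalError-lower-single j j≢i = begin
    signCount * hashCount * (r * freq j)
      ≡⟨ regroup signCount hashCount r (freq j) ⟩
    signCount * freq j * (hashCount * r)
      ≡⟨ cong (signCount * freq j *_) (pair-collisions b n j i j≢i) ⟨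
    signCount * freq j * sumFuns n B (λ h → ind (h j) (h i))
      ≡⟨ sumFuns-* n B (signCount * freq j) _ ⟨
    sumFuns n B (λ h → signCount * freq j * ind (h j) (h i))
      ≡⟨ sumFuns-cong n B (λ h → rotate signCount (freq j) (ind (h j) (h i))) ⟩
    sumFuns n B (λ h → signCount * (ind (h j) (h i) * freq j))
      ≤⟨ sumFuns-mono n B (λ h → signAverage-single h j j≢i) ⟩
    totalError
      ∎
    where
    open ℚₚ.≤-Reasoning
    regroup : ∀ (P H r' f : ℚ) → P * H * (r' * f) ≡ P * f * (H * r')
    regroup = solve-∀ ℚ-ring
    rotate : ∀ (P f c : ℚ) → P * f * c ≡ P * (c * f)
    rotate = solve-∀ ℚ-ring

  -- When B ≤ n the head consists of the items of rank at most B, so its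
  -- weight is H_B up to the missing f_i ≤ 1, and the tail weight is at most
  -- Σ_{j > B} 1/j² ≤ 1/B.
  inHead-or-i : ∀ j → iverson (toℕ j <ᵇ B) ≤ iverson (inHead j) + ind j i
  inHead-or-i j with toℕ j <ᵇ B | does (j ≟ i)
  ... | true  | true  = ℚₚ.≤-refl
  ... | true  | false = ℚₚ.≤-refl
  ... | false | true  = ℚₚ.nonNegative⁻¹ 1ℚ
  ... | false | false = ℚₚ.≤-refl

  inTail-≤ : ∀ j → iverson (inTail j) ≤ iverson (not (toℕ j <ᵇ B))
  inTail-≤ j with toℕ j <ᵇ B
  ... | true  = ℚₚ.≤-refl
  ... | false = iverson-≤1 (not (does (j ≟ i)))

  headRange : B ≤ₙ n → sumFin n (λ j → iverson (toℕ j <ᵇ B) * freq j) ≡ harmonic B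
  headRange B≤n = trans (sumFin-toℕ n (λ k → iverson (k <ᵇ B) * recip k))
    (subst (λ m → sumℕ m (λ k → iverson (k <ᵇ B) * recip k) ≡ harmonic B) (ℕₚ.m+[n∸m]≡n B≤n)
           (sumℕ-below B (n Nat.∸ B) recip))

  headWeight-≤ : B ≤ₙ n → headWeight ≤ harmonic B
  headWeight-≤ B≤n = ℚₚ.≤-trans (sumFin-mono n (λ j → *-monoʳ-≤ (recip-nonneg (toℕ j)) (inHead-≤ j)))
                                (ℚₚ.≤-reflexive (headRange B≤n))

  harmonic-≤-headWeight : B ≤ₙ n → harmonic B ≤ headWeight + 1ℚ
  harmonic-≤-headWeight B≤n = begin
    harmonic B
      ≡⟨ headRange B≤n ⟨
    sumFin n (λ j → iverson (toℕ j <ᵇ B) * freq j)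
      ≤⟨ sumFin-mono n (λ j → *-monoʳ-≤ (recip-nonneg (toℕ j)) (inHead-or-i j)) ⟩
    sumFin n (λ j → (iverson (inHead j) + ind j i) * freq j)
      ≡⟨ sumFin-cong n (λ j → ℚₚ.*-distribʳ-+ (freq j) (iverson (inHead j)) (ind j i)) ⟩
    sumFin n (λ j → iverson (inHead j) * freq j + ind j i * freq j)
      ≡⟨ sumFin-+ n _ _ ⟩
    headWeight + sumFin n (λ j → ind j i * freq j)
      ≡⟨ cong (headWeight +_) (sumFin-sift n i freq) ⟩
    headWeight + freq i
      ≤⟨ ℚₚ.+-monoʳ-≤ headWeight (recip-≤1 (toℕ i)) ⟩
    headWeight + 1ℚ
      ∎
    where open ℚₚ.≤-Reasoning

  tailWeight-≤ : B ≤ₙ n → tailWeight ≤ r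
  tailWeight-≤ B≤n = begin
    tailWeight
      ≤⟨ sumFin-mono n (λ j → *-monoʳ-≤ (square-nonneg (freq j)) (inTail-≤ j)) ⟩
    sumFin n (λ j → iverson (not (toℕ j <ᵇ B)) * recip² (toℕ j))
      ≡⟨ sumFin-toℕ n (λ k → iverson (not (k <ᵇ B)) * recip² k) ⟩
    sumℕ n (λ k → iverson (not (k <ᵇ B)) * recip² k)
      ≡⟨ subst (λ m → sumℕ m (λ k → iverson (not (k <ᵇ B)) * recip² k) ≡ tail) (ℕₚ.m+[n∸m]≡n B≤n)
               (sumℕ-above B (n Nat.∸ B) recip²) ⟩
    tail
      ≤⟨ p≤p+q (recip-nonneg (b Nat.+ (n Nat.∸ B))) ⟩
    tail + recip (b Nat.+ (n Nat.∸ B))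
      ≤⟨ recip²-tail b (n Nat.∸ B) ⟩
    r
      ∎
    where
    open ℚₚ.≤-Reasoning
    tail : ℚ
    tail = sumℕ (n Nat.∸ B) (λ j → recip² (B Nat.+ j))

  instance
    counts-nonzero : NonZero (B Nat.^ n Nat.* 2 Nat.^ n)
    counts-nonzero = ℕₚ.m*n≢0 (B Nat.^ n) (2 Nat.^ n) {{ℕₚ.m^n≢0 B n}} {{ℕₚ.m^n≢0 2 n}}

  normaliser : ℚ
  normaliser = ℤ.+ 1 / (B Nat.^ n Nat.* 2 Nat.^ n)

  normaliser-cancel : ∀ K → signCount * hashCount * K * normaliser ≡ K
  normaliser-cancel K = begin
    signCount * hashCount * K * normaliser          ≡⟨ regroup signCount hashCount K normaliser ⟩
    fromℕ (B Nat.^ n) * signCount * normaliser * K  ≡⟨ cong (λ x → x * normaliser * K) (fromℕ-* (B Nat.^ n) (2 Nat.^ n)) ⟨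
    fromℕ (B Nat.^ n Nat.* 2 Nat.^ n) * normaliser * K ≡⟨ cong (_* K) (fromℕ-inverse (B Nat.^ n Nat.* 2 Nat.^ n)) ⟩
    1ℚ * K                                          ≡⟨ ℚₚ.*-identityˡ K ⟩
    K                                               ∎
    where
    open ≡-Reasoning
    regroup : ∀ (P H K N : ℚ) → P * H * K * N ≡ H * P * N * K
    regroup = solve-∀ ℚ-ring

  normaliser-nonneg : 0ℚ ≤ normaliser
  normaliser-nonneg = ℚₚ.nonNegative⁻¹ normaliser {{ℚₚ.normalize-nonNeg 1 (B Nat.^ n Nat.* 2 Nat.^ n)}}

  expectedError-≥ : ∀ K → signCount * hashCount * K ≤ totalError → K ≤ expectedError n B i
  expectedError-≥ K le = subst (_≤ expectedError n B i) (normaliser-cancel K) (*-monoʳ-≤ normaliser-nonneg le)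

  expectedError-≤ : ∀ K → totalError ≤ signCount * hashCount * K → expectedError n B i ≤ K
  expectedError-≤ K le = subst (expectedError n B i ≤_) (normaliser-cancel K) (*-monoʳ-≤ normaliser-nonneg le)

  expectedError-upper : B ≤ₙ n → expectedError n B i ≤ r * (harmonic B + 1ℚ)
  expectedError-upper B≤n = expectedError-≤ _ (ℚₚ.≤-trans totalError-upper (*-monoˡ-≤ counts-nonneg (begin
    r * headWeight + (tailWeight + r) * ½       ≤⟨ ℚₚ.+-mono-≤ (*-monoˡ-≤ r-nonneg (headWeight-≤ B≤n))
                                                                (*-monoʳ-≤ (ℚₚ.nonNegative⁻¹ ½) (ℚₚ.+-monoˡ-≤ r (tailWeight-≤ B≤n))) ⟩
    r * harmonic B + (r + r) * ½                ≡⟨ simplify r (harmonic B) ⟩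
    r * (harmonic B + 1ℚ)                       ∎)))
    where
    open ℚₚ.≤-Reasoning
    counts-nonneg : 0ℚ ≤ signCount * hashCount
    counts-nonneg = *-nonneg (fromℕ-nonneg (2 Nat.^ n)) (fromℕ-nonneg (B Nat.^ n))
    simplify : ∀ (r' H : ℚ) → r' * H + (r' + r') * ½ ≡ r' * (H + 1ℚ)
    simplify = solve-∀ ℚ-ring

  expectedError-lower : B ≤ₙ n → r * (harmonic B - fromℕ 2) ≤ expectedError n B i
  expectedError-lower B≤n = expectedError-≥ _ (ℚₚ.≤-trans (*-monoˡ-≤ counts-nonneg (begin
    r * (harmonic B - fromℕ 2)                  ≤⟨ *-monoˡ-≤ r-nonneg (ℚₚ.+-monoˡ-≤ (- fromℕ 2) (harmonic-≤-headWeight B≤n)) ⟩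
    r * (headWeight + 1ℚ - fromℕ 2)             ≡⟨ simplify r headWeight ⟩
    r * headWeight - r                          ∎)) totalError-lower-leading)
    where
    open ℚₚ.≤-Reasoning
    counts-nonneg : 0ℚ ≤ signCount * hashCount
    counts-nonneg = *-nonneg (fromℕ-nonneg (2 Nat.^ n)) (fromℕ-nonneg (B Nat.^ n))
    simplify : ∀ (r' W : ℚ) → r' * (W + 1ℚ - fromℕ 2) ≡ r' * W - r'
    simplify = solve-∀ ℚ-ring

  expectedError-lower-single : ∀ j → ¬ j ≡ i → r * freq j ≤ expectedError n B i
  expectedError-lower-single j j≢i = expectedError-≥ _ (totalError-lower-single j j≢i)

heavy-other-item : ∀ {n} → 2 ≤ₙ n → (i : Fin n) → Σ (Fin n) (λ j → ¬ j ≡ i × ½ ≤ freq j)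
heavy-other-item {suc zero}    (s≤s ()) zero
heavy-other-item {suc (suc m)} _ zero    = suc zero , (λ ()) , ℚₚ.≤-refl
heavy-other-item {suc (suc m)} _ (suc i) = zero , (λ ()) , /-≤ 1 1 1 0 (s≤s z≤n)

logOver-recip : ∀ b → logOver (suc b) ≡ fromℕ ⌊log₂ suc b ⌋ * recip b
logOver-recip b = sym (trans (/-* k 0 1 b) (/-≡ (k Nat.* 1) (b Nat.+ 0) k b (cross k b)))
  where
  k : ℕ
  k = ⌊log₂ suc b ⌋
  cross : ∀ k b → k Nat.* 1 Nat.* suc b ≡ k Nat.* suc (b Nat.+ 0)
  cross = ℕ-Solver.solve-∀

-- The constants: with k = ⌊log₂ B⌋ ≥ 1, the bounds (H_B + 1)/B ≤ (k + 3)/B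
-- and (H_B − 2)/B ≥ (k/2 − 1)/B are within the factors 4 and 1/6 of k/B.
⅙ : ℚ
⅙ = ℤ.+ 1 / 6

log-upper-constant : ∀ k → 1 ≤ₙ k → 1ℚ + fromℕ (suc k) + 1ℚ ≤ fromℕ 4 * fromℕ k
log-upper-constant k 1≤k = begin
  1ℚ + fromℕ (suc k) + 1ℚ   ≡⟨ cong₂ _+_ (fromℕ-+ 1 (suc k)) refl ⟨
  fromℕ (2 Nat.+ k) + 1ℚ    ≡⟨ fromℕ-+ (2 Nat.+ k) 1 ⟨
  fromℕ (2 Nat.+ k Nat.+ 1) ≤⟨ fromℕ-mono (subst (Nat._≤ 4 Nat.* k) (shuffle k) (ℕₚ.+-monoʳ-≤ k (ℕₚ.*-monoʳ-≤ 3 1≤k))) ⟩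
  fromℕ (4 Nat.* k)         ≡⟨ fromℕ-* 4 k ⟩
  fromℕ 4 * fromℕ k         ∎
  where
  open ℚₚ.≤-Reasoning
  shuffle : ∀ k → k Nat.+ 3 Nat.* 1 ≡ 2 Nat.+ k Nat.+ 1
  shuffle = ℕ-Solver.solve-∀

log-lower-constant : ∀ k → 3 ≤ₙ k → ⅙ * fromℕ k ≤ 1ℚ + fromℕ k * ½ - fromℕ 2
log-lower-constant k 3≤k = begin
  ⅙ * fromℕ k                                 ≡⟨ cong (⅙ *_) k≡3+m ⟩
  ⅙ * (fromℕ 3 + fromℕ m)                     ≤⟨ p≤p+q (*-nonneg (fromℕ-nonneg m) (ℚₚ.nonNegative⁻¹ (ℤ.+ 1 / 3))) ⟩
  ⅙ * (fromℕ 3 + fromℕ m) + fromℕ m * (ℤ.+ 1 / 3) ≡⟨ identity (fromℕ m) ⟩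
  1ℚ + (fromℕ 3 + fromℕ m) * ½ - fromℕ 2      ≡⟨ cong (λ x → 1ℚ + x * ½ - fromℕ 2) k≡3+m ⟨
  1ℚ + fromℕ k * ½ - fromℕ 2                  ∎
  where
  open ℚₚ.≤-Reasoning
  m : ℕ
  m = k Nat.∸ 3
  k≡3+m : fromℕ k ≡ fromℕ 3 + fromℕ m
  k≡3+m = trans (cong fromℕ (sym (ℕₚ.m+[n∸m]≡n 3≤k))) (fromℕ-+ 3 m)
  identity : ∀ x → ⅙ * (fromℕ 3 + x) + x * (ℤ.+ 1 / 3) ≡ 1ℚ + (fromℕ 3 + x) * ½ - fromℕ 2
  identity = solve-∀ ℚ-ring

count-sketch-log-bounds : ∀ n b (i : Fin n) → 1 ≤ₙ b → suc b ≤ₙ n →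
  (⅙ * logOver (suc b) ≤ expectedError n (suc b) i) × (expectedError n (suc b) i ≤ fromℕ 4 * logOver (suc b))
count-sketch-log-bounds n b i 1≤b B≤n =
  subst (λ x → ⅙ * x ≤ expectedError n (suc b) i) (sym (logOver-recip b)) lower ,
  subst (λ x → expectedError n (suc b) i ≤ fromℕ 4 * x) (sym (logOver-recip b)) upper
  where
  open CountSketch n b i using (r; r-nonneg; expectedError-upper; expectedError-lower; expectedError-lower-single)
  open ℚₚ.≤-Reasoning
  k : ℕ
  k = ⌊log₂ suc b ⌋
  1≤k : 1 ≤ₙ k
  1≤k = ⌊log₂⌋-mono-≤ {2} {suc b} (s≤s 1≤b)
  H-bounds : (1ℚ + fromℕ k * ½ ≤ harmonic (suc b)) × (harmonic (suc b) ≤ 1ℚ + fromℕ (suc k))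
  H-bounds = harmonic-log (suc b) (s≤s z≤n)
  reorder : ∀ (c x r' : ℚ) → c * (x * r') ≡ r' * (c * x)
  reorder = solve-∀ ℚ-ring
  upper : expectedError n (suc b) i ≤ fromℕ 4 * (fromℕ k * r)
  upper = begin
    expectedError n (suc b) i             ≤⟨ expectedError-upper B≤n ⟩
    r * (harmonic (suc b) + 1ℚ)           ≤⟨ *-monoˡ-≤ r-nonneg (ℚₚ.+-monoˡ-≤ 1ℚ (proj₂ H-bounds)) ⟩
    r * (1ℚ + fromℕ (suc k) + 1ℚ)         ≤⟨ *-monoˡ-≤ r-nonneg (log-upper-constant k 1≤k) ⟩
    r * (fromℕ 4 * fromℕ k)               ≡⟨ reorder (fromℕ 4) (fromℕ k) r ⟨
    fromℕ 4 * (fromℕ k * r)               ∎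
  ⅙*3≡½ : ⅙ * fromℕ 3 ≡ ½
  ⅙*3≡½ = trans (/-* 1 5 3 0) (/-≡ (1 Nat.* 3) 5 1 1 refl)
  lower-small : k ≤ₙ 3 → ⅙ * (fromℕ k * r) ≤ expectedError n (suc b) i
  lower-small k≤3 = from-heavy-item (heavy-other-item (ℕₚ.≤-trans (s≤s 1≤b) B≤n) i)
    where
    from-heavy-item : Σ (Fin n) (λ j → ¬ j ≡ i × ½ ≤ freq j) → ⅙ * (fromℕ k * r) ≤ expectedError n (suc b) i
    from-heavy-item (j , j≢i , ½≤fⱼ) = begin
      ⅙ * (fromℕ k * r)                   ≡⟨ reorder ⅙ (fromℕ k) r ⟩
      r * (⅙ * fromℕ k)                   ≤⟨ *-monoˡ-≤ r-nonneg (*-monoˡ-≤ (ℚₚ.nonNegative⁻¹ ⅙) (fromℕ-mono k≤3)) ⟩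
      r * (⅙ * fromℕ 3)                   ≡⟨ cong (r *_) ⅙*3≡½ ⟩
      r * ½                               ≤⟨ *-monoˡ-≤ r-nonneg ½≤fⱼ ⟩
      r * freq j                          ≤⟨ expectedError-lower-single j j≢i ⟩
      expectedError n (suc b) i           ∎
  lower-large : 3 ≤ₙ k → ⅙ * (fromℕ k * r) ≤ expectedError n (suc b) i
  lower-large 3≤k = begin
    ⅙ * (fromℕ k * r)                     ≡⟨ reorder ⅙ (fromℕ k) r ⟩
    r * (⅙ * fromℕ k)                     ≤⟨ *-monoˡ-≤ r-nonneg (log-lower-constant k 3≤k) ⟩
    r * (1ℚ + fromℕ k * ½ - fromℕ 2)      ≤⟨ *-monoˡ-≤ r-nonneg (ℚₚ.+-monoˡ-≤ (- fromℕ 2) (proj₁ H-bounds)) ⟩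
    r * (harmonic (suc b) - fromℕ 2)      ≤⟨ expectedError-lower B≤n ⟩
    expectedError n (suc b) i             ∎
  lower : ⅙ * (fromℕ k * r) ≤ expectedError n (suc b) i
  lower = by-size (k Nat.≤? 3)
    where
    by-size : Dec (k ≤ₙ 3) → ⅙ * (fromℕ k * r) ≤ expectedError n (suc b) i
    by-size (yes k≤3) = lower-small k≤3
    by-size (no  k≰3) = lower-large (ℕₚ.<⇒≤ (ℕₚ.≰⇒> k≰3))

theorem4p3 : Σ ℚ (λ c → Σ ℚ (λ C → (0ℚ < c) × (0ℚ < C) ×
               ((n B : ℕ) .{{_ : NonZero B}} → 2 ≤ₙ B → B ≤ₙ n → (i : Fin n) →
                 (c * logOver B ≤ expectedError n B i) × (expectedError n B i ≤ C * logOver B))))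
theorem4p3 = ⅙ , fromℕ 4 , ℚₚ.positive⁻¹ ⅙ , ℚₚ.positive⁻¹ (fromℕ 4) , bounds
  where
  bounds : (n B : ℕ) .{{_ : NonZero B}} → 2 ≤ₙ B → B ≤ₙ n → (i : Fin n) →
           (⅙ * logOver B ≤ expectedError n B i) × (expectedError n B i ≤ fromℕ 4 * logOver B)
  bounds n (suc b) (s≤s 1≤b) B≤n i = count-sketch-log-bounds n b i 1≤b B≤n
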